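{- Let $R_0=B_2B_3\cdots B_n$ with $B_c=(c-1)(c-2)\cdots1$, a reduced word of $w_0\in S_n$. Then for every $(d,e,f)\in\mathcal T_n$, $T_{R_0}(d,e,f)=1$ and $\Theta_{R_0}(d,e,f)=-1$.
   Context: $S_n$ has simple transpositions $s_i$, length $\ell$, $w_0=n\cdots1$, $N=\binom n2$. $\mathcal T_n=\{(a,b,c)\in[n]^3:a<b<c\}$. $T_R$: for $R=i_1\cdots i_N$ a reduced word of $w_0$, start from the identity in one-line notation and successively swap the entries in positions $i_t,i_t+1$; $\tau_R(a,b)$ ($a<b$) is the step at which values $a,b$ become inverted; $T_R(a,b,c)=1$ if $\tau_R(a,b)<\tau_R(b,c)$, else $-1$. $\Theta_R$: for $x\in S_n$, $\mathrm{wt}_R(x)\in\mathbb Z[q]$ is the sum of $q^{d_N}$ over subsets of positions $a_1<\dots<a_m$ with $s_{i_{a_1}}\cdots s_{i_{a_m}}=x$, where $x_0=e,d_0=0$, and for each $k$: $d_k=d_{k-1}+1$ if [$k$ selected] $\Leftrightarrow$ [$\ell(x_{k-1}s_{i_k})>\ell(x_{k-1})$], else $d_k=d_{k-1}$; $x_k=x_{k-1}s_{i_k}$ if $k$ selected, else $x_{k-1}$. $D_R(x)=[q^{N-1}]\mathrm{wt}_R(x)$. With $\mathrm{pos}_x(t)=x^{ -1}(t)$, $\mathrm{Supp}(x)=\{t:\mathrm{pos}_x(t)\neq\mathrm{pos}_{w_0}(t)\}$, $\sigma_b(x)=\mathrm{sgn}(\mathrm{pos}_x(b)-\mathrm{pos}_{w_0}(b))$,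 and $\Theta_R(a,b,c)=\sum_{x:\ \mathrm{Supp}(x)=[a,c]\cap\mathbb Z}D_R(x)\sigma_b(x)$. -}

module Defs where

open import Data.Nat using (ℕ; zero; suc; _+_; _∸_; _<ᵇ_; _≤ᵇ_; _≡ᵇ_)
open import Data.Nat.Combinatorics using (_C_)
open import Data.Bool using (Bool; true; false; if_then_else_; _∧_; not)
open import Data.List using (List; []; _∷_; _++_; map; foldr; concatMap; upTo; length)
open import Data.Nat.ListAction using (sum)
open import Data.List.Properties using (≡-dec)
open import Data.Product using (_×_; _,_; proj₁; proj₂)
open import Data.Integer as ℤ using (ℤ; +_; -[1+_])
import Data.Nat as ℕ
open import Relation.Nullary.Decidable using (⌊_⌋)

-- Conventions: a permutation x ∈ S_n is represented by its one-line
-- notation, a List ℕ of the values 1..n.  Positions are 1-based.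
-- A word R = i_1 ⋯ i_N is a List ℕ of indices of simple transpositions.

-- swap the entries in (1-based) positions i, i+1  (right multiplication by s_i)
swapAt : ℕ → List ℕ → List ℕ
swapAt zero xs = xs
swapAt (suc zero) (x ∷ y ∷ xs) = y ∷ x ∷ xs
swapAt (suc zero) xs = xs
swapAt (suc (suc i)) [] = []
swapAt (suc (suc i)) (x ∷ xs) = x ∷ swapAt (suc i) xs

idPerm : ℕ → List ℕ
idPerm n = map suc (upTo n)

-- pos_x(t) = x^{-1}(t): 1-based position of value t (0 if absent)
pos : List ℕ → ℕ → ℕ
pos [] t = zero
pos (x ∷ xs) t = if x ≡ᵇ t then 1 else (if pos xs t ≡ᵇ 0 then 0 else suc (pos xs t))

-- pos_{w0}(t) for w0 = n ⋯ 1
posW0 : ℕ → ℕ → ℕ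
posW0 n t = suc n ∸ t

-- Coxeter length = number of inversions of the one-line notation
len : List ℕ → ℕ
len [] = 0
len (x ∷ xs) = sum (map (λ y → if y <ᵇ x then 1 else 0) xs) + len xs

-- first step t ≥ 1 (counting from k) at which, after applying the swap of step t,
-- value a stands to the right of value b; 0 if it never happens.
firstInv : ℕ → ℕ → ℕ → List ℕ → List ℕ → ℕ
firstInv a b k x [] = 0
firstInv a b k x (i ∷ R) =
  let x' = swapAt i x in
  if pos x' b <ᵇ pos x' a then k else firstInv a b (suc k) x' R

τ : ℕ → List ℕ → ℕ → ℕ → ℕ
τ n R a b = firstInv a b 1 (idPerm n) R

T : ℕ → List ℕ → ℕ → ℕ → ℕ → ℤ
T n R a b c = if τ n R a b <ᵇ τ n R b c then + 1 else -[1+ 0 ]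

walk : List ℕ → List Bool → List ℕ → ℕ → List ℕ × ℕ
walk [] _ x d = x , d
walk (i ∷ R) [] x d = x , d
walk (i ∷ R) (b ∷ bs) x d =
  let xs = swapAt i x
      up = len x <ᵇ len xs
      agree = if b then up else not up
  in walk R bs (if b then xs else x) (if agree then suc d else d)

-- all subsets of positions 1..m, as selection vectors of length m
subsets : ℕ → List (List Bool)
subsets zero = [] ∷ []
subsets (suc m) = map (true ∷_) (subsets m) ++ map (false ∷_) (subsets m)

filterᵇ : {A : Set} → (A → Bool) → List A → List A
filterᵇ p [] = []
filterᵇ p (x ∷ xs) = if p x then x ∷ filterᵇ p xs else filterᵇ p xs

eqList : List ℕ → List ℕ → Bool
eqList u v = ⌊ ≡-dec ℕ._≟_ u v ⌋

Nn : ℕ → ℕ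
Nn n = n C 2

-- D_R(x) = [q^{N-1}] wt_R(x): number of subsets with product x and d_N = N-1
D : ℕ → List ℕ → List ℕ → ℕ
D n R x = length (filterᵇ (λ S → eqList (proj₁ (walk R S (idPerm n) 0)) x
                              ∧ (proj₂ (walk R S (idPerm n) 0) ≡ᵇ (Nn n ∸ 1)))
                         (subsets (length R)))

insertAll : ℕ → List ℕ → List (List ℕ)
insertAll v [] = (v ∷ []) ∷ []
insertAll v (x ∷ xs) = (v ∷ x ∷ xs) ∷ map (x ∷_) (insertAll v xs)

perms : ℕ → List (List ℕ)
perms zero = [] ∷ []
perms (suc n) = concatMap (insertAll (suc n)) (perms n)

suppIs : ℕ → List ℕ → ℕ → ℕ → Bool
suppIs n x a c =
  foldr _∧_ true
    (map (λ t → if not (pos x t ≡ᵇ posW0 n t)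
                  then ((a ≤ᵇ t) ∧ (t ≤ᵇ c))
                  else not ((a ≤ᵇ t) ∧ (t ≤ᵇ c)))
         (idPerm n))

σ : ℕ → List ℕ → ℕ → ℤ
σ n x b = if pos x b <ᵇ posW0 n b then -[1+ 0 ]
          else (if posW0 n b <ᵇ pos x b then + 1 else + 0)

Θ : ℕ → List ℕ → ℕ → ℕ → ℕ → ℤ
Θ n R a b c =
  foldr ℤ._+_ (+ 0)
    (map (λ x → (+ D n R x) ℤ.* σ n x b) (filterᵇ (λ x → suppIs n x a c) (perms n)))

desc : ℕ → List ℕ
desc zero = []
desc (suc k) = suc k ∷ desc k

B : ℕ → List ℕ
B c = desc (c ∸ 1)

R0 : ℕ → List ℕ
R0 zero = []
R0 (suc m) = R0 m ++ B (suc m)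

module Submission where

-- Walks along R reach d_N = N − 1 exactly when one step fails to raise d, so D_R(x) counts the
-- steps at which flipping the choice of the greedy walk (and continuing greedily) ends at x.
-- Along R₀ = B₂ ⋯ Bₙ from the identity, the greedy walk bubbles each new value to the front,
-- and the ends of these one-flip walks are the permutations obtained from w₀ by moving p + q + 1
-- from the front to the back of a block p + q + 1, …, p + 1 with q ≥ 1, one for each such block.
-- Such a permutation has support [p + 1, p + q + 1], and the values strictly inside the block
-- stand one place left of their place in w₀; so in Θ(d, e, f) only the block with p + 1 = d
-- and p + q + 1 = f contributes, with sign −1.  For T, values a < b first become inverted in
-- the block B_b, at its a-th letter, so τ(a, b) = ℓ(B₂ ⋯ B_{b−1}) + a, which increases from
-- (d, e) to (e, f).

open import Data.Bool using (Bool; true; false; if_then_else_; _∧_; not)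
open import Data.Bool.Properties
  using (∧-zeroʳ; ∧-identityʳ; ∧-conicalˡ; ∧-conicalʳ; not-involutive; T-≡)
open import Data.Empty using (⊥-elim)
open import Data.Integer as ℤ using (ℤ; +_; -[1+_])
import Data.Integer.Properties as ℤₚ
open import Algebra.Properties.CommutativeSemigroup ℤₚ.+-commutativeSemigroup using (interchange)
open import Data.List using (List; []; _∷_; _++_; map; foldr; length; concatMap; applyUpTo)
open import Data.List.Membership.Propositional using (_∈_)
open import Data.List.Properties
  using (length-++; ++-assoc; ++-identityʳ; map-cong-local; map-applyUpTo; map-∘; map-++; ≡-dec)
open import Data.List.Relation.Unary.All as All using (All; []; _∷_)
import Data.List.Relation.Unary.All.Properties as All
open import Data.List.Relation.Unary.Any using (here; there)
open import Data.Nat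
  using (ℕ; zero; suc; _+_; _*_; _∸_; _<ᵇ_; _≤ᵇ_; _≡ᵇ_; _≤_; _<_; z≤n; s≤s; _≤′_; ≤′-refl; ≤′-step)
open import Data.Nat.Combinatorics using (_C_; nC1≡n; nCk+nC[k+1]≡[n+1]C[k+1])
open import Data.Nat.ListAction using (sum)
open import Data.Nat.Properties
open import Data.Nat.Tactic.RingSolver using (solve-∀)
open import Data.Product using (_×_; _,_; proj₁; proj₂; Σ; map₂)
open import Defs
open import Function using (id; _∘_)
open import Function.Bundles using (Equivalence)
open import Relation.Binary using (Tri; tri<; tri≈; tri>)
open import Relation.Binary.PropositionalEquality
open import Relation.Nullary using (yes; no)
open import Relation.Nullary.Decidable using (dec-true; dec-false; isYes≗does)

ind : Bool → ℕ
ind b = if b then 1 else 0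

∑ : {A : Set} → (A → ℤ) → List A → ℤ
∑ f xs = foldr ℤ._+_ (+ 0) (map f xs)

∑-map : {A B : Set} (f : B → ℤ) (g : A → B) (xs : List A) → ∑ f (map g xs) ≡ ∑ (λ x → f (g x)) xs
∑-map f g [] = refl
∑-map f g (x ∷ xs) = cong (ℤ._+_ (f (g x))) (∑-map f g xs)

∑-cong : {A : Set} {f g : A → ℤ} (xs : List A) → (∀ x → f x ≡ g x) → ∑ f xs ≡ ∑ g xs
∑-cong [] e = refl
∑-cong (x ∷ xs) e = cong₂ ℤ._+_ (e x) (∑-cong xs e)

∑-congᴬ : {A : Set} {P : A → Set} {f g : A → ℤ} {xs : List A} →
  All P xs → (∀ {x} → P x → f x ≡ g x) → ∑ f xs ≡ ∑ g xs
∑-congᴬ [] e = refl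
∑-congᴬ (px ∷ pxs) e = cong₂ ℤ._+_ (e px) (∑-congᴬ pxs e)

∑-+ : {A : Set} (f g : A → ℤ) (xs : List A) → ∑ (λ x → f x ℤ.+ g x) xs ≡ ∑ f xs ℤ.+ ∑ g xs
∑-+ f g [] = refl
∑-+ f g (x ∷ xs) = trans (cong (ℤ._+_ (f x ℤ.+ g x)) (∑-+ f g xs)) (interchange (f x) (g x) _ _)

countᵇ : {A : Set} → (A → Bool) → List A → ℕ
countᵇ p [] = 0
countᵇ p (x ∷ xs) = ind (p x) + countᵇ p xs

countᵇ-++ : {A : Set} (p : A → Bool) (xs ys : List A) → countᵇ p (xs ++ ys) ≡ countᵇ p xs + countᵇ p ys
countᵇ-++ p [] ys = refl
countᵇ-++ p (x ∷ xs) ys = trans (cong (_+_ (ind (p x))) (countᵇ-++ p xs ys)) (sym (+-assoc (ind (p x)) _ _))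

countᵇ-map : {A B : Set} (p : B → Bool) (g : A → B) (xs : List A) →
  countᵇ p (map g xs) ≡ countᵇ (λ x → p (g x)) xs
countᵇ-map p g [] = refl
countᵇ-map p g (x ∷ xs) = cong (_+_ (ind (p (g x)))) (countᵇ-map p g xs)

countᵇ-cong : {A : Set} {p q : A → Bool} (xs : List A) →
  (∀ x → p x ≡ q x) → countᵇ p xs ≡ countᵇ q xs
countᵇ-cong [] e = refl
countᵇ-cong (x ∷ xs) e = cong₂ _+_ (cong ind (e x)) (countᵇ-cong xs e)

countᵇ-congᴬ : {A : Set} {P : A → Set} {p q : A → Bool} {xs : List A} →
  All P xs → (∀ {x} → P x → p x ≡ q x) → countᵇ p xs ≡ countᵇ q xs
countᵇ-congᴬ [] e = refl
countᵇ-congᴬ (px ∷ pxs) e = cong₂ _+_ (cong ind (e px)) (countᵇ-congᴬ pxs e)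

countᵇ-none : {A : Set} (p : A → Bool) (xs : List A) → (∀ x → p x ≡ false) → countᵇ p xs ≡ 0
countᵇ-none p [] none = refl
countᵇ-none p (x ∷ xs) none = cong₂ _+_ (cong ind (none x)) (countᵇ-none p xs none)

countᵇ-∧ʳ : {A : Set} (g : A → Bool) (b : Bool) (xs : List A) →
  countᵇ (λ x → g x ∧ b) xs ≡ (if b then countᵇ g xs else 0)
countᵇ-∧ʳ g true xs = countᵇ-cong xs (λ x → ∧-identityʳ (g x))
countᵇ-∧ʳ g false xs = countᵇ-none _ xs (λ x → ∧-zeroʳ (g x))

length-filterᵇ : {A : Set} (p : A → Bool) (xs : List A) → length (filterᵇ p xs) ≡ countᵇ p xs
length-filterᵇ p [] = refl
length-filterᵇ p (x ∷ xs) with p x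
... | true = cong suc (length-filterᵇ p xs)
... | false = length-filterᵇ p xs

∑-negate-ind : {A : Set} (p : A → Bool) (xs : List A) →
  ∑ (λ x → ℤ.- (+ ind (p x))) xs ≡ ℤ.- (+ countᵇ p xs)
∑-negate-ind p [] = refl
∑-negate-ind p (x ∷ xs) =
  trans (cong (ℤ._+_ (ℤ.- (+ ind (p x)))) (∑-negate-ind p xs)) (sym (ℤₚ.neg-distrib-+ (+ ind (p x)) _))

eqList-refl : ∀ u → eqList u u ≡ true
eqList-refl u = trans (isYes≗does (≡-dec _≟_ u u)) (dec-true (≡-dec _≟_ u u) refl)

eqList-≢ : ∀ {u v} → u ≢ v → eqList u v ≡ false
eqList-≢ {u} {v} u≢v = trans (isYes≗does (≡-dec _≟_ u v)) (dec-false (≡-dec _≟_ u v) u≢v)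

eqList-∷ : ∀ a b u v → eqList (a ∷ u) (b ∷ v) ≡ (a ≡ᵇ b) ∧ eqList u v
eqList-∷ a b u v =
  trans (isYes≗does (≡-dec _≟_ (a ∷ u) (b ∷ v)))
        (cong ((a ≡ᵇ b) ∧_) (sym (isYes≗does (≡-dec _≟_ u v))))

eqList-∷-≡ : ∀ a u v → eqList (a ∷ u) (a ∷ v) ≡ eqList u v
eqList-∷-≡ a u v = trans (eqList-∷ a a u v) (cong (_∧ eqList u v) (dec-true (a ≟ a) refl))

eqList-∷-≢ : ∀ {a b} u v → a ≢ b → eqList (a ∷ u) (b ∷ v) ≡ false
eqList-∷-≢ {a} {b} u v a≢b = trans (eqList-∷ a b u v) (cong (_∧ eqList u v) (dec-false (a ≟ b) a≢b))

∑-ind-eqList : (y : List ℕ) (F : List ℕ → ℤ) (L : List (List ℕ)) →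
  ∑ (λ x → + ind (eqList y x) ℤ.* F x) L ≡ + countᵇ (eqList y) L ℤ.* F y
∑-ind-eqList y F [] = refl
∑-ind-eqList y F (x ∷ L) with ≡-dec _≟_ y x
... | yes refl = trans (cong₂ ℤ._+_ (ℤₚ.*-identityˡ (F y)) (∑-ind-eqList y F L))
                       (sym (ℤₚ.suc-* (+ countᵇ (eqList y) L) (F y)))
... | no _ = trans (ℤₚ.+-identityˡ _) (∑-ind-eqList y F L)

∑-count-swap : (L E : List (List ℕ)) (F : List ℕ → ℤ) →
  ∑ (λ x → + countᵇ (λ z → eqList z x) E ℤ.* F x) L ≡ ∑ (λ y → + countᵇ (eqList y) L ℤ.* F y) E
∑-count-swap L [] F = ∑-zero L
  where
  ∑-zero : (L : List (List ℕ)) → ∑ (λ x → + 0 ℤ.* F x) L ≡ + 0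
  ∑-zero [] = refl
  ∑-zero (_ ∷ L) = trans (ℤₚ.+-identityˡ _) (∑-zero L)
∑-count-swap L (y ∷ E) F = begin
  ∑ (λ x → + (ind (eqList y x) + mult x) ℤ.* F x) L
    ≡⟨ ∑-cong L (λ x → ℤₚ.*-distribʳ-+ (F x) (+ ind (eqList y x)) (+ mult x)) ⟩
  ∑ (λ x → + ind (eqList y x) ℤ.* F x ℤ.+ + mult x ℤ.* F x) L
    ≡⟨ ∑-+ (λ x → + ind (eqList y x) ℤ.* F x) _ L ⟩
  ∑ (λ x → + ind (eqList y x) ℤ.* F x) L ℤ.+ ∑ (λ x → + mult x ℤ.* F x) L
    ≡⟨ cong₂ ℤ._+_ (∑-ind-eqList y F L) (∑-count-swap L E F) ⟩
  + countᵇ (eqList y) L ℤ.* F y ℤ.+ ∑ (λ y → + countᵇ (eqList y) L ℤ.* F y) E ∎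
  where
  open ≡-Reasoning
  mult : List ℕ → ℕ
  mult x = countᵇ (λ z → eqList z x) E

countᵇ-eqList-filterᵇ : (y : List ℕ) (p : List ℕ → Bool) (L : List (List ℕ)) →
  countᵇ (eqList y) (filterᵇ p L) ≡ ind (p y) * countᵇ (eqList y) L
countᵇ-eqList-filterᵇ y p [] = sym (*-zeroʳ (ind (p y)))
countᵇ-eqList-filterᵇ y p (x ∷ L) with p x in px | ≡-dec _≟_ y x
... | true | yes refl rewrite px =
  cong₂ _+_ (cong ind (eqList-refl y)) (trans (countᵇ-eqList-filterᵇ y p L) (cong (_* _) (cong ind px)))
... | false | yes refl rewrite px = trans (countᵇ-eqList-filterᵇ y p L) (cong (_* _) (cong ind px))
... | true | no y≢x = cong₂ _+_ (cong ind (eqList-≢ y≢x)) (countᵇ-eqList-filterᵇ y p L)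
... | false | no _ = countᵇ-eqList-filterᵇ y p L

-- Walks along a word

ascends : ℕ → List ℕ → Bool
ascends i x = len x <ᵇ len (swapAt i x)

raise lower : ℕ → List ℕ → List ℕ
raise i x = if ascends i x then swapAt i x else x
lower i x = if ascends i x then x else swapAt i x

-- the end of the walk from x along R in which every step raises d, i.e. the Demazure product x ⋆ R
greedy : List ℕ → List ℕ → List ℕ
greedy [] x = x
greedy (i ∷ R) x = greedy R (raise i x)

-- the ends of the walks in which exactly one step fails to raise d, listed by that step
oneFlipEnds : List ℕ → List ℕ → List (List ℕ)
oneFlipEnds [] x = []
oneFlipEnds (i ∷ R) x = greedy R (lower i x) ∷ oneFlipEnds R (raise i x)

count : List ℕ → List (List ℕ) → ℕ
count y = countᵇ (λ z → eqList z y)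

endsAt : List ℕ → ℕ → List ℕ × ℕ → Bool
endsAt y t w = eqList (proj₁ w) y ∧ (proj₂ w ≡ᵇ t)

walksTo : List ℕ → List ℕ → ℕ → List ℕ → ℕ → ℕ
walksTo R x d y t = countᵇ (λ S → endsAt y t (walk R S x d)) (subsets (length R))

walk-bound : ∀ R S x d → proj₂ (walk R S x d) ≤ length R + d
walk-bound [] S x d = ≤-refl
walk-bound (i ∷ R) [] x d = m≤n+m d (suc (length R))
walk-bound (i ∷ R) (b ∷ S) x d =
  ≤-trans (walk-bound R S _ _)
          (≤-trans (+-monoʳ-≤ (length R) (step≤ _)) (≤-reflexive (+-suc (length R) d)))
  where
  step≤ : ∀ a → (if a then suc d else d) ≤ suc d
  step≤ true = ≤-refl
  step≤ false = n≤1+n d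

-- Selecting s_i raises d exactly when it ascends, and skipping it exactly when it does not.
walksTo-∷ : ∀ i R x d y t →
  walksTo (i ∷ R) x d y t ≡ walksTo R (raise i x) (suc d) y t + walksTo R (lower i x) d y t
walksTo-∷ i R x d y t =
  trans (countᵇ-++ _ (map (true ∷_) L) (map (false ∷_) L))
        (trans (cong₂ _+_ (countᵇ-map _ (true ∷_) L) (countᵇ-map _ (false ∷_) L)) (split (ascends i x)))
  where
  L = subsets (length R)
  ends : List ℕ → ℕ → ℕ
  ends x′ d′ = countᵇ (λ S → endsAt y t (walk R S x′ d′)) L
  split : ∀ u → ends (swapAt i x) (if u then suc d else d) + ends x (if not u then suc d else d)
              ≡ ends (if u then swapAt i x else x) (suc d) + ends (if u then x else swapAt i x) d
  split true = refl
  split false = +-comm (ends (swapAt i x) d) _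

walksTo-beyond : ∀ R x d y t → length R + d < t → walksTo R x d y t ≡ 0
walksTo-beyond R x d y t lt = countᵇ-none _ (subsets (length R)) λ S →
  trans (cong (eqList (proj₁ (walk R S x d)) y ∧_)
              (dec-false (_ ≟ t) (<⇒≢ (≤-<-trans (walk-bound R S x d) lt))))
        (∧-zeroʳ _)

walksTo-greedy : ∀ R x d y → walksTo R x d y (length R + d) ≡ ind (eqList (greedy R x) y)
walksTo-greedy [] x d y =
  trans (+-identityʳ _) (cong ind (trans (cong (eqList x y ∧_) (dec-true (d ≟ d) refl)) (∧-identityʳ _)))
walksTo-greedy (i ∷ R) x d y = begin
  walksTo (i ∷ R) x d y (suc (length R + d))
    ≡⟨ walksTo-∷ i R x d y _ ⟩
  walksTo R (raise i x) (suc d) y (suc (length R + d)) + walksTo R (lower i x) d y (suc (length R + d))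
    ≡⟨ cong₂ _+_ (cong (walksTo R (raise i x) (suc d) y) (sym (+-suc (length R) d)))
                 (walksTo-beyond R (lower i x) d y _ ≤-refl) ⟩
  walksTo R (raise i x) (suc d) y (length R + suc d) + 0
    ≡⟨ trans (+-identityʳ _) (walksTo-greedy R (raise i x) (suc d) y) ⟩
  ind (eqList (greedy R (raise i x)) y) ∎
  where open ≡-Reasoning

walksTo-oneFlip : ∀ i R x d y → walksTo (i ∷ R) x d y (length R + d) ≡ count y (oneFlipEnds (i ∷ R) x)
walksTo-oneFlip i R x d y =
  trans (walksTo-∷ i R x d y _)
        (trans (cong₂ _+_ (flipLater R) (walksTo-greedy R (lower i x) d y))
               (+-comm (count y (oneFlipEnds R (raise i x))) _))
  where
  flipLater : ∀ R → walksTo R (raise i x) (suc d) y (length R + d) ≡ count y (oneFlipEnds R (raise i x))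
  flipLater [] =
    cong (λ b → ind b + 0)
         (trans (cong (eqList (raise i x) y ∧_) (dec-false (suc d ≟ d) (λ ()))) (∧-zeroʳ _))
  flipLater (j ∷ R) = trans (cong (walksTo (j ∷ R) (raise i x) (suc d) y) (sym (+-suc (length R) d)))
                            (walksTo-oneFlip j R (raise i x) (suc d) y)

D≡count-oneFlipEnds : ∀ n i R x → length (i ∷ R) ≡ Nn n →
  D n (i ∷ R) x ≡ count x (oneFlipEnds (i ∷ R) (idPerm n))
D≡count-oneFlipEnds n i R x len≡N =
  trans (length-filterᵇ _ (subsets (length (i ∷ R))))
        (trans (cong (walksTo (i ∷ R) (idPerm n) 0 x) N∸1) (walksTo-oneFlip i R (idPerm n) 0 x))
  where
  N∸1 : Nn n ∸ 1 ≡ length R + 0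
  N∸1 = trans (cong (_∸ 1) (sym len≡N)) (sym (+-identityʳ (length R)))

run↓ : ℕ → ℕ → List ℕ
run↓ lo zero = []
run↓ lo (suc k) = lo + k ∷ run↓ lo k

run↑ : ℕ → ℕ → List ℕ
run↑ a zero = []
run↑ a (suc k) = suc a ∷ run↑ (suc a) k

length-run↓ : ∀ lo k → length (run↓ lo k) ≡ k
length-run↓ lo zero = refl
length-run↓ lo (suc k) = cong suc (length-run↓ lo k)

run↓-+ : ∀ lo k j → run↓ lo (k + j) ≡ run↓ (lo + j) k ++ run↓ lo j
run↓-+ lo zero j = refl
run↓-+ lo (suc k) j = cong₂ _∷_ (trans (cong (_+_ lo) (+-comm k j)) (sym (+-assoc lo j k))) (run↓-+ lo k j)

run↓-∷ʳ : ∀ lo k → run↓ lo (suc k) ≡ run↓ (suc lo) k ++ lo ∷ []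
run↓-∷ʳ lo k = trans (cong (run↓ lo) (+-comm 1 k))
  (trans (run↓-+ lo k 1) (cong₂ (λ a b → run↓ a k ++ b ∷ []) (+-comm lo 1) (+-identityʳ lo)))

run↓-bounds : ∀ lo k → All (λ x → lo ≤ x × x < lo + k) (run↓ lo k)
run↓-bounds lo zero = []
run↓-bounds lo (suc k) = (m≤m+n lo k , +-monoʳ-< lo (n<1+n k))
  ∷ All.map (λ (lo≤x , x<) → lo≤x , <-trans x< (+-monoʳ-< lo (n<1+n k))) (run↓-bounds lo k)

run↑-bounds : ∀ a k → All (λ x → a < x × x ≤ a + k) (run↑ a k)
run↑-bounds a zero = []
run↑-bounds a (suc k) = (n<1+n a , ≤-trans (s≤s (m≤m+n a k)) (≤-reflexive (sym (+-suc a k))))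
  ∷ All.map (λ (a<x , x≤) → <-trans (n<1+n a) a<x , ≤-trans x≤ (≤-reflexive (sym (+-suc a k))))
            (run↑-bounds (suc a) k)

idPerm≡run↑ : ∀ n → idPerm n ≡ run↑ 0 n
idPerm≡run↑ n = trans (map-applyUpTo id suc n) (go 0 n id (λ _ → refl))
  where
  go : ∀ a k (f : ℕ → ℕ) → (∀ i → f i ≡ a + i) → applyUpTo (suc ∘ f) k ≡ run↑ a k
  go a zero f f≗ = refl
  go a (suc k) f f≗ = cong₂ _∷_ (cong suc (trans (f≗ 0) (+-identityʳ a)))
    (go (suc a) k (f ∘ suc) (λ i → trans (f≗ (suc i)) (+-suc a i)))

desc-∷ʳ : ∀ k → desc (suc k) ≡ map suc (desc k) ++ 1 ∷ []
desc-∷ʳ zero = refl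
desc-∷ʳ (suc k) = cong (suc (suc k) ∷_) (desc-∷ʳ k)

length-desc : ∀ k → length (desc k) ≡ k
length-desc zero = refl
length-desc (suc k) = cong suc (length-desc k)

summand≢0 : ∀ {x a b} → x + a ≡ b → a < b → x ≢ 0
summand≢0 x+a≡b a<b refl = <-irrefl x+a≡b a<b

pos-head : ∀ t xs → pos (t ∷ xs) t ≡ 1
pos-head t xs rewrite dec-true (t ≟ t) refl = refl

pos-head≢0 : ∀ t xs → pos (t ∷ xs) t ≢ 0
pos-head≢0 t xs e with () ← trans (sym (pos-head t xs)) e

pos-∷ : ∀ {x t} xs → x ≢ t → pos xs t ≢ 0 → pos (x ∷ xs) t ≡ suc (pos xs t)
pos-∷ {x} {t} xs x≢t present rewrite dec-false (x ≟ t) x≢t | dec-false (pos xs t ≟ 0) present = refl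

pos-++ : ∀ {t Z} X → All (_≢ t) X → pos Z t ≢ 0 → pos (X ++ Z) t ≡ length X + pos Z t
pos-++ [] _ _ = refl
pos-++ {t} {Z} (x ∷ X) (x≢t ∷ X∌t) present =
  trans (pos-∷ (X ++ Z) x≢t (λ p≡0 → present (m+n≡0⇒n≡0 (length X) (trans (sym IH) p≡0))))
        (cong suc IH)
  where IH = pos-++ X X∌t present

pos-run↓ : ∀ {t} lo k Z → lo ≤ t → t < lo + k → pos (run↓ lo k ++ Z) t + t ≡ lo + k
pos-run↓ lo zero Z lo≤t t<lo+0 = ⊥-elim (<⇒≱ (≤-trans t<lo+0 (≤-reflexive (+-identityʳ lo))) lo≤t)
pos-run↓ {t} lo (suc k) Z lo≤t t<lo+k+1 with lo + k ≟ t
... | yes refl = trans (cong (_+ (lo + k)) (pos-head (lo + k) (run↓ lo k ++ Z))) (sym (+-suc lo k))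
... | no lo+k≢t = begin
  pos (lo + k ∷ run↓ lo k ++ Z) t + t     ≡⟨ cong (_+ t) (pos-∷ (run↓ lo k ++ Z) lo+k≢t present) ⟩
  suc (pos (run↓ lo k ++ Z) t + t)       ≡⟨ cong suc IH ⟩
  suc (lo + k)                           ≡⟨ sym (+-suc lo k) ⟩
  lo + suc k                             ∎
  where
  open ≡-Reasoning
  t<lo+k : t < lo + k
  t<lo+k = ≤∧≢⇒< (≤-pred (≤-trans t<lo+k+1 (≤-reflexive (+-suc lo k)))) (lo+k≢t ∘ sym)
  IH = pos-run↓ lo k Z lo≤t t<lo+k
  present = summand≢0 IH t<lo+k

run↓-∌-below : ∀ {t} lo k → t < lo → All (_≢ t) (run↓ lo k)
run↓-∌-below lo k t<lo =
  All.map (λ (lo≤x , _) x≡t → <⇒≱ t<lo (subst (lo ≤_) x≡t lo≤x)) (run↓-bounds lo k)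

run↓-∌-above : ∀ {t} lo k → lo + k ≤ t → All (_≢ t) (run↓ lo k)
run↓-∌-above lo k lo+k≤t =
  All.map (λ (_ , x<) x≡t → <⇒≱ (subst (_< lo + k) x≡t x<) lo+k≤t) (run↓-bounds lo k)

pos-absent : ∀ {t} xs → All (_≢ t) xs → pos xs t ≡ 0
pos-absent [] _ = refl
pos-absent {t} (x ∷ xs) (x≢t ∷ xs∌t) rewrite dec-false (x ≟ t) x≢t | pos-absent xs xs∌t = refl

pos-≤-length : ∀ {t} X M → All (_≢ t) M → pos (X ++ M) t ≤ length X
pos-≤-length [] M M∌t = ≤-reflexive (pos-absent M M∌t)
pos-≤-length {t} (x ∷ X) M M∌t with x ≡ᵇ t | pos (X ++ M) t | pos-≤-length X M M∌t
... | true | _ | _ = s≤s z≤n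
... | false | zero | _ = z≤n
... | false | suc _ | p≤ = s≤s p≤

pos-run↑ : ∀ {t} a k → a < t → t ≤ a + k → pos (run↑ a k) t + a ≡ t
pos-run↑ a zero a<t t≤a+0 = ⊥-elim (<⇒≱ a<t (≤-trans t≤a+0 (≤-reflexive (+-identityʳ a))))
pos-run↑ {t} a (suc k) a<t t≤a+k+1 with suc a ≟ t
... | yes refl = cong (_+ a) (pos-head (suc a) (run↑ (suc a) k))
... | no 1+a≢t = begin
  pos (suc a ∷ run↑ (suc a) k) t + a
    ≡⟨ cong (_+ a) (pos-∷ (run↑ (suc a) k) 1+a≢t (summand≢0 IH 1+a<t)) ⟩
  suc (pos (run↑ (suc a) k) t) + a
    ≡⟨ sym (+-suc (pos (run↑ (suc a) k) t) a) ⟩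
  pos (run↑ (suc a) k) t + suc a
    ≡⟨ IH ⟩
  t ∎
  where
  open ≡-Reasoning
  1+a<t = ≤∧≢⇒< a<t 1+a≢t
  IH = pos-run↑ (suc a) k 1+a<t (≤-trans t≤a+k+1 (≤-reflexive (+-suc a k)))

run↑-∌ : ∀ {t} a k → t ≤ a → All (_≢ t) (run↑ a k)
run↑-∌ a k t≤a = All.map (λ (a<x , _) x≡t → <⇒≱ a<x (subst (_≤ a) (sym x≡t) t≤a)) (run↑-bounds a k)

≤-∌ : ∀ {v t X} → All (_≤ v) X → v < t → All (_≢ t) X
≤-∌ X≤v v<t = All.map (λ x≤v x≡t → <⇒≱ v<t (subst (_≤ _) x≡t x≤v)) X≤v

pos-++-run↑ : ∀ {v k t} X → All (_≤ v) X → v < t → t ≤ v + k →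
  pos (X ++ run↑ v k) t ≡ length X + pos (run↑ v k) t × pos (run↑ v k) t + v ≡ t
pos-++-run↑ {v} {k} X X≤v v<t t≤v+k = pos-++ X (≤-∌ X≤v v<t) (summand≢0 inTail v<t) , inTail
  where inTail = pos-run↑ v k v<t t≤v+k

increasing-tail : ∀ {α β v k} X → All (_≤ v) X → v < β → β ≤ v + k → α < β →
  pos (X ++ run↑ v k) α < pos (X ++ run↑ v k) β
increasing-tail {α} {β} {v} {k} X X≤v v<β β≤v+k α<β with pos-++-run↑ X X≤v v<β β≤v+k | α ≤? v
... | posβ , inTailβ | yes α≤v = begin-strict
  pos (X ++ run↑ v k) α       ≤⟨ pos-≤-length X (run↑ v k) (run↑-∌ v k α≤v) ⟩
  length X                    <⟨ m<m+n (length X) (n≢0⇒n>0 (summand≢0 inTailβ v<β)) ⟩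
  length X + pos (run↑ v k) β ≡⟨ sym posβ ⟩
  pos (X ++ run↑ v k) β       ∎
  where open ≤-Reasoning
... | posβ , inTailβ | no α≰v with pos-++-run↑ X X≤v (≰⇒> α≰v) (≤-trans (<⇒≤ α<β) β≤v+k)
...   | posα , inTailα = subst₂ _<_ (sym posα) (sym posβ)
  (+-monoʳ-< (length X) (+-cancelʳ-< v _ _ (subst₂ _<_ (sym inTailα) (sym inTailβ) α<β)))

≡ᵇ-∸ : ∀ x t N → t ≤ N → (x ≡ᵇ N ∸ t) ≡ (x + t ≡ᵇ N)
≡ᵇ-∸ x t N t≤N with x + t ≟ N
... | yes refl = trans (dec-true (x ≟ x + t ∸ t) (sym (m+n∸n≡m x t))) (sym (dec-true (x + t ≟ x + t) refl))
... | no x+t≢N = trans (dec-false (x ≟ N ∸ t) (λ x≡ → x+t≢N (trans (cong (_+ t) x≡) (m∸n+n≡m t≤N))))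
                     (sym (dec-false (x + t ≟ N) x+t≢N))

smaller : ℕ → List ℕ → ℕ
smaller z xs = sum (map (λ y → if y <ᵇ z then 1 else 0) xs)

smaller-swapAt : ∀ j z xs → smaller z (swapAt j xs) ≡ smaller z xs
smaller-swapAt zero z xs = refl
smaller-swapAt (suc zero) z [] = refl
smaller-swapAt (suc zero) z (a ∷ []) = refl
smaller-swapAt (suc zero) z (a ∷ b ∷ xs) =
  trans (sym (+-assoc (ind (b <ᵇ z)) (ind (a <ᵇ z)) _))
        (trans (cong (_+ smaller z xs) (+-comm (ind (b <ᵇ z)) _)) (+-assoc (ind (a <ᵇ z)) _ _))
smaller-swapAt (suc (suc j)) z [] = refl
smaller-swapAt (suc (suc j)) z (a ∷ xs) = cong (_+_ (ind (a <ᵇ z))) (smaller-swapAt (suc j) z xs)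

+-cancelˡ-<ᵇ : ∀ c m n → (c + m <ᵇ c + n) ≡ (m <ᵇ n)
+-cancelˡ-<ᵇ zero m n = refl
+-cancelˡ-<ᵇ (suc c) m n = +-cancelˡ-<ᵇ c m n

ascends-∷ : ∀ i z xs → ascends (suc (suc i)) (z ∷ xs) ≡ ascends (suc i) xs
ascends-∷ i z xs =
  trans (cong (λ s → smaller z xs + len xs <ᵇ s + len (swapAt (suc i) xs)) (smaller-swapAt (suc i) z xs))
        (+-cancelˡ-<ᵇ (smaller z xs) _ _)

ascends-1 : ∀ a b xs → ascends 1 (a ∷ b ∷ xs) ≡ (a <ᵇ b)
ascends-1 a b xs =
  trans (cong₂ _<ᵇ_ (swap-sum (ind (b <ᵇ a)) sa sb (len xs)) (swap-sum′ (ind (a <ᵇ b)) sa sb (len xs)))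
        (trans (+-cancelˡ-<ᵇ (sa + sb + len xs) _ _) (compare (<-cmp a b)))
  where
  sa = smaller a xs
  sb = smaller b xs
  swap-sum : ∀ i x y l → (i + x) + (y + l) ≡ (x + y + l) + i
  swap-sum = solve-∀
  swap-sum′ : ∀ i x y l → (i + y) + (x + l) ≡ (x + y + l) + i
  swap-sum′ = solve-∀
  compare : Tri (a < b) (a ≡ b) (b < a) → (ind (b <ᵇ a) <ᵇ ind (a <ᵇ b)) ≡ (a <ᵇ b)
  compare (tri< a<b _ b≮a) rewrite dec-false (b <? a) b≮a | dec-true (a <? b) a<b = refl
  compare (tri≈ a≮b _ b≮a) rewrite dec-false (b <? a) b≮a | dec-false (a <? b) a≮b = refl
  compare (tri> a≮b _ b<a) rewrite dec-true (b <? a) b<a | dec-false (a <? b) a≮b = refl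

raise-∷ : ∀ i z xs → raise (suc (suc i)) (z ∷ xs) ≡ z ∷ raise (suc i) xs
raise-∷ i z xs rewrite ascends-∷ i z xs with ascends (suc i) xs
... | true = refl
... | false = refl

lower-∷ : ∀ i z xs → lower (suc (suc i)) (z ∷ xs) ≡ z ∷ lower (suc i) xs
lower-∷ i z xs rewrite ascends-∷ i z xs with ascends (suc i) xs
... | true = refl
... | false = refl

raise-1-< : ∀ {a b} xs → a < b → raise 1 (a ∷ b ∷ xs) ≡ b ∷ a ∷ xs
raise-1-< {a} {b} xs a<b rewrite ascends-1 a b xs | dec-true (a <? b) a<b = refl

raise-1-> : ∀ {a b} xs → b < a → raise 1 (a ∷ b ∷ xs) ≡ a ∷ b ∷ xs
raise-1-> {a} {b} xs b<a rewrite ascends-1 a b xs | dec-false (a <? b) (<-asym b<a) = refl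

lower-1-< : ∀ {a b} xs → a < b → lower 1 (a ∷ b ∷ xs) ≡ a ∷ b ∷ xs
lower-1-< {a} {b} xs a<b rewrite ascends-1 a b xs | dec-true (a <? b) a<b = refl

greedy-++ : ∀ R R′ x → greedy (R ++ R′) x ≡ greedy R′ (greedy R x)
greedy-++ [] R′ x = refl
greedy-++ (i ∷ R) R′ x = greedy-++ R R′ (raise i x)

oneFlipEnds-++ : ∀ R R′ x →
  oneFlipEnds (R ++ R′) x ≡ map (greedy R′) (oneFlipEnds R x) ++ oneFlipEnds R′ (greedy R x)
oneFlipEnds-++ [] R′ x = refl
oneFlipEnds-++ (i ∷ R) R′ x = cong₂ _∷_ (greedy-++ R R′ (lower i x)) (oneFlipEnds-++ R R′ (raise i x))

greedy-∷ : ∀ k z xs → greedy (map suc (desc k)) (z ∷ xs) ≡ z ∷ greedy (desc k) xs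
greedy-∷ zero z xs = refl
greedy-∷ (suc k) z xs =
  trans (cong (greedy (map suc (desc k))) (raise-∷ k z xs)) (greedy-∷ k z (raise (suc k) xs))

oneFlipEnds-∷ : ∀ k z xs → oneFlipEnds (map suc (desc k)) (z ∷ xs) ≡ map (z ∷_) (oneFlipEnds (desc k) xs)
oneFlipEnds-∷ zero z xs = refl
oneFlipEnds-∷ (suc k) z xs = cong₂ _∷_
  (trans (cong (greedy (map suc (desc k))) (lower-∷ k z xs)) (greedy-∷ k z (lower (suc k) xs)))
  (trans (cong (oneFlipEnds (map suc (desc k))) (raise-∷ k z xs)) (oneFlipEnds-∷ k z (raise (suc k) xs)))

greedy-bubble : ∀ P v M → All (_< v) P → greedy (desc (length P)) (P ++ v ∷ M) ≡ v ∷ P ++ M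
greedy-bubble [] v M [] = refl
greedy-bubble (z ∷ P) v M (z<v ∷ P<v) = begin
  greedy (desc (suc (length P))) (z ∷ P ++ v ∷ M)
    ≡⟨ cong (λ R → greedy R (z ∷ P ++ v ∷ M)) (desc-∷ʳ (length P)) ⟩
  greedy (map suc (desc (length P)) ++ 1 ∷ []) (z ∷ P ++ v ∷ M)
    ≡⟨ greedy-++ (map suc (desc (length P))) (1 ∷ []) _ ⟩
  raise 1 (greedy (map suc (desc (length P))) (z ∷ P ++ v ∷ M))
    ≡⟨ cong (raise 1) (greedy-∷ (length P) z (P ++ v ∷ M)) ⟩
  raise 1 (z ∷ greedy (desc (length P)) (P ++ v ∷ M))
    ≡⟨ cong (λ y → raise 1 (z ∷ y)) (greedy-bubble P v M P<v) ⟩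
  raise 1 (z ∷ v ∷ P ++ M)
    ≡⟨ raise-1-< (P ++ M) z<v ⟩
  v ∷ z ∷ P ++ M ∎
  where open ≡-Reasoning

-- the permutations of 1, …, m, built as perms builds them: by inserting m into one of 1, …, m ∸ 1
data Perm : ℕ → List ℕ → Set where
  empty : Perm zero []
  insert : ∀ {m} l₁ l₂ → Perm m (l₁ ++ l₂) → Perm (suc m) (l₁ ++ suc m ∷ l₂)

Perm-bound : ∀ {m y} → Perm m y → All (_≤ m) y
Perm-bound empty = []
Perm-bound (insert l₁ l₂ π) =
  All.++⁺ (All.map m≤n⇒m≤1+n (All.++⁻ˡ l₁ b)) (≤-refl ∷ All.map m≤n⇒m≤1+n (All.++⁻ʳ l₁ b))
  where b = Perm-bound π

insertAll-bound : ∀ {P : ℕ → Set} {v} l → P v → All P l → All (All P) (insertAll v l)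
insertAll-bound [] pv [] = (pv ∷ []) ∷ []
insertAll-bound (x ∷ xs) pv (px ∷ pxs) =
  (pv ∷ px ∷ pxs) ∷ All.map⁺ (All.map (px ∷_) (insertAll-bound xs pv pxs))

perms-bound : ∀ m → All (All (_≤ m)) (perms m)
perms-bound zero = [] ∷ []
perms-bound (suc m) =
  All.concat⁺ (All.map⁺ (All.map (λ {l} l≤m → insertAll-bound l ≤-refl (All.map m≤n⇒m≤1+n l≤m))
                                 (perms-bound m)))

count-insertAll : ∀ v l₁ l₂ l → All (_≢ v) l₁ → All (_≢ v) l →
  countᵇ (eqList (l₁ ++ v ∷ l₂)) (insertAll v l) ≡ ind (eqList (l₁ ++ l₂) l)
count-insertAll v [] l₂ [] _ _ = trans (+-identityʳ _) (cong ind (eqList-∷-≡ v l₂ []))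
count-insertAll v [] l₂ (x ∷ xs) _ (x≢v ∷ _) = begin
  ind (eqList (v ∷ l₂) (v ∷ x ∷ xs)) + countᵇ (eqList (v ∷ l₂)) (map (x ∷_) (insertAll v xs))
    ≡⟨ cong₂ _+_ (cong ind (eqList-∷-≡ v l₂ (x ∷ xs)))
                 (trans (countᵇ-map _ (x ∷_) (insertAll v xs))
                        (countᵇ-none _ (insertAll v xs) λ w → eqList-∷-≢ l₂ w (x≢v ∘ sym))) ⟩
  ind (eqList l₂ (x ∷ xs)) + 0
    ≡⟨ +-identityʳ _ ⟩
  ind (eqList l₂ (x ∷ xs)) ∎
  where open ≡-Reasoning
count-insertAll v (z ∷ l₁) l₂ [] (z≢v ∷ _) _ =
  cong (λ b → ind b + 0) (eqList-∷-≢ (l₁ ++ v ∷ l₂) [] z≢v)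
count-insertAll v (z ∷ l₁) l₂ (x ∷ xs) (z≢v ∷ l₁∌v) (_ ∷ xs∌v) = begin
  ind (eqList (z ∷ l₁ ++ v ∷ l₂) (v ∷ x ∷ xs))
    + countᵇ (eqList (z ∷ l₁ ++ v ∷ l₂)) (map (x ∷_) (insertAll v xs))
    ≡⟨ cong₂ _+_ (cong ind (eqList-∷-≢ (l₁ ++ v ∷ l₂) (x ∷ xs) z≢v))
                 (trans (countᵇ-map _ (x ∷_) (insertAll v xs)) (countᵇ-cong (insertAll v xs) (eqList-∷ z x _))) ⟩
  countᵇ (λ w → (z ≡ᵇ x) ∧ eqList (l₁ ++ v ∷ l₂) w) (insertAll v xs)
    ≡⟨ byHead (z ≡ᵇ x) ⟩
  ind ((z ≡ᵇ x) ∧ eqList (l₁ ++ l₂) xs)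
    ≡⟨ cong ind (sym (eqList-∷ z x (l₁ ++ l₂) xs)) ⟩
  ind (eqList (z ∷ l₁ ++ l₂) (x ∷ xs)) ∎
  where
  open ≡-Reasoning
  byHead : ∀ b →
    countᵇ (λ w → b ∧ eqList (l₁ ++ v ∷ l₂) w) (insertAll v xs) ≡ ind (b ∧ eqList (l₁ ++ l₂) xs)
  byHead true = count-insertAll v l₁ l₂ xs l₁∌v xs∌v
  byHead false = countᵇ-none _ (insertAll v xs) (λ _ → refl)

count-perms : ∀ {m y} → Perm m y → countᵇ (eqList y) (perms m) ≡ 1
count-perms empty = refl
count-perms {suc m} (insert l₁ l₂ π) = trans (countInserted (perms m) (perms-bound m)) (count-perms π)
  where
  ≤⇒≢ : ∀ {z} → z ≤ m → z ≢ suc m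
  ≤⇒≢ z≤m refl = <-irrefl refl z≤m
  countInserted : ∀ L → All (All (_≤ m)) L →
    countᵇ (eqList (l₁ ++ suc m ∷ l₂)) (concatMap (insertAll (suc m)) L) ≡ countᵇ (eqList (l₁ ++ l₂)) L
  countInserted [] _ = refl
  countInserted (l ∷ L) (l≤m ∷ L≤m) =
    trans (countᵇ-++ _ (insertAll (suc m) l) _)
          (cong₂ _+_ (count-insertAll (suc m) l₁ l₂ l (All.map ≤⇒≢ (All.++⁻ˡ l₁ (Perm-bound π)))
                                                       (All.map ≤⇒≢ l≤m))
                     (countInserted L L≤m))

Perm-run↓ : ∀ k → Perm k (run↓ 1 k)
Perm-run↓ zero = empty
Perm-run↓ (suc k) = insert [] (run↓ 1 k) (Perm-run↓ k)

-- One-flip ends along R₀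

splits : ℕ → List (ℕ × ℕ)
splits zero = []
splits (suc k) = map (map₂ suc) (splits k) ++ (k , 1) ∷ []

IsSplit : ℕ → ℕ × ℕ → Set
IsSplit k (s , j) = s + j ≡ k × 1 ≤ j

splits-valid : ∀ k → All (IsSplit k) (splits k)
splits-valid zero = []
splits-valid (suc k) = All.++⁺ (All.map⁺ (All.map longer (splits-valid k))) ((+-comm k 1 , ≤-refl) ∷ [])
  where
  longer : ∀ {sj} → IsSplit k sj → IsSplit (suc k) (map₂ suc sj)
  longer {s , j} (s+j≡k , _) = trans (+-suc s j) (cong suc s+j≡k) , s≤s z≤n

-- v on its way to the front of the run lo + s + j ∸ 1, …, lo: it has passed s values, j remain
bubbled : ℕ → ℕ → List ℕ → ℕ × ℕ → List ℕ
bubbled lo v M (s , j) = run↓ (lo + s) j ++ v ∷ run↓ lo s ++ M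

oneFlipEnds-desc : ∀ lo k v M → lo + k ≤ v →
  oneFlipEnds (desc k) (run↓ lo k ++ v ∷ M) ≡ map (bubbled lo v M) (splits k)
oneFlipEnds-desc lo zero v M _ = refl
oneFlipEnds-desc lo (suc k) v M lo+k<v = begin
  oneFlipEnds (desc (suc k)) (lo + k ∷ Y)
    ≡⟨ cong (λ R → oneFlipEnds R (lo + k ∷ Y)) (desc-∷ʳ k) ⟩
  oneFlipEnds (map suc (desc k) ++ 1 ∷ []) (lo + k ∷ Y)
    ≡⟨ oneFlipEnds-++ (map suc (desc k)) (1 ∷ []) (lo + k ∷ Y) ⟩
  map (raise 1) (oneFlipEnds (map suc (desc k)) (lo + k ∷ Y)) ++ lower 1 (greedy (map suc (desc k)) (lo + k ∷ Y)) ∷ []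
    ≡⟨ cong₂ (λ E y → map (raise 1) E ++ lower 1 y ∷ [])
             (oneFlipEnds-∷ k (lo + k) Y) (greedy-∷ k (lo + k) Y) ⟩
  map (raise 1) (map (lo + k ∷_) (oneFlipEnds (desc k) Y)) ++ lower 1 (lo + k ∷ greedy (desc k) Y) ∷ []
    ≡⟨ cong₂ (λ E y → map (raise 1) (map (lo + k ∷_) E) ++ lower 1 (lo + k ∷ y) ∷ [])
             (oneFlipEnds-desc lo k v M (<⇒≤ lo+k<v′)) bubble ⟩
  map (raise 1) (map (lo + k ∷_) (map (bubbled lo v M) (splits k))) ++ lower 1 (lo + k ∷ v ∷ run↓ lo k ++ M) ∷ []
    ≡⟨ cong₂ (λ E y → E ++ y ∷ [])
             (trans (sym (trans (map-∘ _) (map-∘ _))) (map-cong-local (All.map stillAbove (splits-valid k))))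
             (trans (lower-1-< _ lo+k<v′) (cong (λ w → w ∷ v ∷ run↓ lo k ++ M) (sym (+-identityʳ (lo + k))))) ⟩
  map (bubbled lo v M ∘ map₂ suc) (splits k) ++ bubbled lo v M (k , 1) ∷ []
    ≡⟨ cong (_++ bubbled lo v M (k , 1) ∷ []) (map-∘ (splits k)) ⟩
  map (bubbled lo v M) (map (map₂ suc) (splits k)) ++ map (bubbled lo v M) ((k , 1) ∷ [])
    ≡⟨ sym (map-++ (bubbled lo v M) (map (map₂ suc) (splits k)) _) ⟩
  map (bubbled lo v M) (splits (suc k)) ∎
  where
  open ≡-Reasoning
  Y = run↓ lo k ++ v ∷ M
  lo+k<v′ : lo + k < v
  lo+k<v′ = ≤-trans (≤-reflexive (sym (+-suc lo k))) lo+k<v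
  bubble : greedy (desc k) Y ≡ v ∷ run↓ lo k ++ M
  bubble = trans (cong (λ j → greedy (desc j) Y) (sym (length-run↓ lo k)))
    (greedy-bubble (run↓ lo k) v M (All.map (λ (_ , x<) → <-trans x< lo+k<v′) (run↓-bounds lo k)))
  stillAbove : ∀ {sj} → IsSplit k sj → raise 1 (lo + k ∷ bubbled lo v M sj) ≡ bubbled lo v M (map₂ suc sj)
  stillAbove {s , suc j} (s+j≡k , _) =
    trans (raise-1-> _ (subst (lo + s + j <_) top (+-monoʳ-< (lo + s) (n<1+n j))))
          (cong (λ w → w ∷ bubbled lo v M (s , suc j)) (sym top))
    where
    top : lo + s + suc j ≡ lo + k
    top = trans (+-assoc lo s (suc j)) (cong (_+_ lo) s+j≡k)

-- w₀ with the value p + q + 1 moved from the front to the back of its block p + q + 1, …, p + 1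
rotated : ℕ × ℕ × ℕ → List ℕ
rotated (p , q , r) = run↓ (suc (suc (p + q))) r ++ run↓ (suc p) q ++ suc (p + q) ∷ run↓ 1 p

Perm-rotated : ∀ p q r → Perm (suc (p + q + r)) (rotated (p , q , r))
Perm-rotated p q zero = subst (λ k → Perm (suc k) (rotated (p , q , 0))) (sym (+-identityʳ (p + q)))
  (insert (run↓ (suc p) q) (run↓ 1 p) (subst₂ Perm (+-comm q p) (run↓-+ 1 q p) (Perm-run↓ (q + p))))
Perm-rotated p q (suc r) = subst (λ k → Perm (suc k) (rotated (p , q , suc r))) (sym (+-suc (p + q) r))
  (insert [] (rotated (p , q , r)) (Perm-rotated p q r))

length-rotated : ∀ p q r → length (rotated (p , q , r)) ≡ suc (p + q + r)
length-rotated p q r = begin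
  length (run↓ (suc (suc (p + q))) r ++ run↓ (suc p) q ++ suc (p + q) ∷ run↓ 1 p)
    ≡⟨ length-++ (run↓ (suc (suc (p + q))) r) ⟩
  length (run↓ (suc (suc (p + q))) r) + (length (run↓ (suc p) q ++ suc (p + q) ∷ run↓ 1 p))
    ≡⟨ cong (_+_ (length (run↓ (suc (suc (p + q))) r))) (length-++ (run↓ (suc p) q)) ⟩
  length (run↓ (suc (suc (p + q))) r) + (length (run↓ (suc p) q) + suc (length (run↓ 1 p)))
    ≡⟨ cong₂ (λ a b → a + (b + suc (length (run↓ 1 p)))) (length-run↓ _ r) (length-run↓ _ q) ⟩
  r + (q + suc (length (run↓ 1 p)))
    ≡⟨ cong (λ c → r + (q + suc c)) (length-run↓ 1 p) ⟩
  r + (q + suc p)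
    ≡⟨ reorder r q p ⟩
  suc (p + q + r) ∎
  where
  open ≡-Reasoning
  reorder : ∀ r q p → r + (q + suc p) ≡ suc (p + q + r)
  reorder = solve-∀

triples : ℕ → List (ℕ × ℕ × ℕ)
triples zero = []
triples (suc m) = map (map₂ (map₂ suc)) (triples m) ++ map (λ (s , j) → s , j , 0) (splits m)

IsTriple : ℕ → ℕ × ℕ × ℕ → Set
IsTriple m (p , q , r) = suc (p + q + r) ≡ m × 1 ≤ q

triples-valid : ∀ m → All (IsTriple m) (triples m)
triples-valid zero = []
triples-valid (suc m) =
  All.++⁺ (All.map⁺ (All.map deeper (triples-valid m))) (All.map⁺ (All.map lastBlock (splits-valid m)))
  where
  deeper : ∀ {t} → IsTriple m t → IsTriple (suc m) (map₂ (map₂ suc) t)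
  deeper {p , q , r} (e , 1≤q) = trans (cong suc (+-suc (p + q) r)) (cong suc e) , 1≤q
  lastBlock : ∀ {sj} → IsSplit m sj → IsTriple (suc m) (proj₁ sj , proj₂ sj , 0)
  lastBlock {s , j} (e , 1≤j) = cong suc (trans (+-identityʳ (s + j)) e) , 1≤j

greedy-R0 : ∀ m k → greedy (R0 m) (run↑ 0 (m + k)) ≡ run↓ 1 m ++ run↑ m k
greedy-R0 zero k = refl
greedy-R0 (suc m) k = begin
  greedy (R0 m ++ desc m) (run↑ 0 (suc m + k))
    ≡⟨ greedy-++ (R0 m) (desc m) _ ⟩
  greedy (desc m) (greedy (R0 m) (run↑ 0 (suc m + k)))
    ≡⟨ cong (λ n → greedy (desc m) (greedy (R0 m) (run↑ 0 n))) (sym (+-suc m k)) ⟩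
  greedy (desc m) (greedy (R0 m) (run↑ 0 (m + suc k)))
    ≡⟨ cong (greedy (desc m)) (greedy-R0 m (suc k)) ⟩
  greedy (desc m) (run↓ 1 m ++ suc m ∷ run↑ (suc m) k)
    ≡⟨ cong (λ j → greedy (desc j) (run↓ 1 m ++ suc m ∷ run↑ (suc m) k)) (sym (length-run↓ 1 m)) ⟩
  greedy (desc (length (run↓ 1 m))) (run↓ 1 m ++ suc m ∷ run↑ (suc m) k)
    ≡⟨ greedy-bubble (run↓ 1 m) (suc m) (run↑ (suc m) k) (All.map proj₂ (run↓-bounds 1 m)) ⟩
  suc m ∷ run↓ 1 m ++ run↑ (suc m) k ∎
  where open ≡-Reasoning

oneFlipEnds-R0 : ∀ m k →
  oneFlipEnds (R0 m) (run↑ 0 (m + k)) ≡ map (λ t → rotated t ++ run↑ m k) (triples m)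
oneFlipEnds-R0 zero k = refl
oneFlipEnds-R0 (suc m) k = begin
  oneFlipEnds (R0 m ++ desc m) (run↑ 0 (suc m + k))
    ≡⟨ cong (λ n → oneFlipEnds (R0 m ++ desc m) (run↑ 0 n)) (sym (+-suc m k)) ⟩
  oneFlipEnds (R0 m ++ desc m) X
    ≡⟨ oneFlipEnds-++ (R0 m) (desc m) X ⟩
  map (greedy (desc m)) (oneFlipEnds (R0 m) X) ++ oneFlipEnds (desc m) (greedy (R0 m) X)
    ≡⟨ cong₂ (λ E y → map (greedy (desc m)) E ++ oneFlipEnds (desc m) y)
             (oneFlipEnds-R0 m (suc k)) (greedy-R0 m (suc k)) ⟩
  map (greedy (desc m)) (map (λ t → rotated t ++ suc m ∷ U) (triples m))
    ++ oneFlipEnds (desc m) (run↓ 1 m ++ suc m ∷ U)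
    ≡⟨ cong₂ _++_ (trans (sym (map-∘ (triples m)))
                         (map-cong-local (All.map (λ {t} → bubbleUp {t}) (triples-valid m))))
                  (oneFlipEnds-desc 1 m (suc m) U ≤-refl) ⟩
  map (λ t → rotated (map₂ (map₂ suc) t) ++ U) (triples m) ++ map (bubbled 1 (suc m) U) (splits m)
    ≡⟨ cong₂ _++_ (map-∘ (triples m))
                  (trans (map-cong-local (All.map (λ {sj} → lastBlock {sj}) (splits-valid m))) (map-∘ (splits m))) ⟩
  map (λ t → rotated t ++ U) (map (map₂ (map₂ suc)) (triples m))
    ++ map (λ t → rotated t ++ U) (map (λ (s , j) → s , j , 0) (splits m))
    ≡⟨ sym (map-++ (λ t → rotated t ++ U) (map (map₂ (map₂ suc)) (triples m)) _) ⟩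
  map (λ t → rotated t ++ U) (triples (suc m)) ∎
  where
  open ≡-Reasoning
  X = run↑ 0 (m + suc k)
  U = run↑ (suc m) k
  bubbleUp : ∀ {t} → IsTriple m t → greedy (desc m) (rotated t ++ suc m ∷ U) ≡ rotated (map₂ (map₂ suc) t) ++ U
  bubbleUp {p , q , r} (e , _) =
    trans (cong (λ j → greedy (desc j) (y ++ suc m ∷ U)) (sym (trans (length-rotated p q r) e)))
          (trans (greedy-bubble y (suc m) U (subst (λ n → All (_< suc n) y) e y<))
                 (cong (_∷ y ++ U) (sym (cong suc e))))
    where
    y = rotated (p , q , r)
    y< = All.map s≤s (Perm-bound (Perm-rotated p q r))
  lastBlock : ∀ {sj} → IsSplit m sj → bubbled 1 (suc m) U sj ≡ rotated (proj₁ sj , proj₂ sj , 0) ++ U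
  lastBlock {s , j} (e , _) =
    trans (cong (λ w → run↓ (suc s) j ++ w ∷ run↓ 1 s ++ U) (cong suc (sym e)))
          (sym (++-assoc (run↓ (suc s) j) _ U))

length-R0 : ∀ m → length (R0 m) ≡ Nn m
length-R0 zero = refl
length-R0 (suc m) = begin
  length (R0 m ++ desc m)         ≡⟨ length-++ (R0 m) ⟩
  length (R0 m) + length (desc m) ≡⟨ cong₂ _+_ (length-R0 m) (length-desc m) ⟩
  m C 2 + m                       ≡⟨ +-comm (m C 2) m ⟩
  m + m C 2                       ≡⟨ cong (_+ m C 2) (sym (nC1≡n m)) ⟩
  m C 1 + m C 2                   ≡⟨ nCk+nC[k+1]≡[n+1]C[k+1] m 1 ⟩
  suc m C 2                       ∎
  where open ≡-Reasoning

R0-∷ : ∀ m → Σ (List ℕ) λ R → R0 (suc (suc m)) ≡ 1 ∷ R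
R0-∷ zero = [] , refl
R0-∷ (suc m) with R0-∷ m
... | R , R0≡ = R ++ desc (suc (suc m)) , cong (_++ desc (suc (suc m))) R0≡

inInterval : ℕ → ℕ → ℕ → Bool
inInterval a c t = (a ≤ᵇ t) ∧ (t ≤ᵇ c)

agree : Bool → Bool → Bool
agree b b′ = if b then b′ else not b′

sameOn : ℕ → (ℕ → Bool) → (ℕ → Bool) → Bool
sameOn n P Q = foldr _∧_ true (map (λ t → agree (P t) (Q t)) (run↑ 0 n))

foldr-∧-true : ∀ (g : ℕ → Bool) {L} → All (λ t → g t ≡ true) L → foldr _∧_ true (map g L) ≡ true
foldr-∧-true g [] = refl
foldr-∧-true g (gt ∷ gts) rewrite gt = foldr-∧-true g gts

foldr-∧-false : ∀ (g : ℕ → Bool) {t L} → t ∈ L → g t ≡ false → foldr _∧_ true (map g L) ≡ false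
foldr-∧-false g (here refl) gt rewrite gt = refl
foldr-∧-false g {L = x ∷ L} (there t∈L) gt =
  trans (cong (g x ∧_) (foldr-∧-false g t∈L gt)) (∧-zeroʳ (g x))

∈-run↑ : ∀ {t} a k → a < t → t ≤ a + k → t ∈ run↑ a k
∈-run↑ a zero a<t t≤a+0 = ⊥-elim (<⇒≱ a<t (≤-trans t≤a+0 (≤-reflexive (+-identityʳ a))))
∈-run↑ {t} a (suc k) a<t t≤a+k+1 with t ≟ suc a
... | yes t≡1+a = here t≡1+a
... | no t≢1+a =
  there (∈-run↑ (suc a) k (≤∧≢⇒< a<t (t≢1+a ∘ sym)) (≤-trans t≤a+k+1 (≤-reflexive (+-suc a k))))

sameInterval : ∀ n {a c d f} → 1 ≤ a → a ≤ c → c ≤ n → 1 ≤ d → d ≤ f → f ≤ n →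
  sameOn n (inInterval a c) (inInterval d f) ≡ (a ≡ᵇ d) ∧ (c ≡ᵇ f)
sameInterval n {a} {c} {d} {f} 1≤a a≤c c≤n 1≤d d≤f f≤n with a ≟ d | c ≟ f
... | yes refl | yes refl =
  trans (foldr-∧-true _ {run↑ 0 n} (All.tabulate λ {t} _ → agree-refl (inInterval a c t)))
        (sym (cong₂ _∧_ (dec-true (a ≟ a) refl) (dec-true (c ≟ c) refl)))
  where
  agree-refl : ∀ b → agree b b ≡ true
  agree-refl true = refl
  agree-refl false = refl
... | yes refl | no c≢f =
  trans (differAt (<-cmp c f))
        (sym (trans (cong (_∧ (c ≡ᵇ f)) (dec-true (a ≟ a) refl)) (dec-false (c ≟ f) c≢f)))
  where
  differAt : Tri (c < f) (c ≡ f) (f < c) → sameOn n (inInterval a c) (inInterval a f) ≡ false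
  differAt (tri< c<f _ _) = foldr-∧-false _ (∈-run↑ 0 n (≤-trans 1≤a a≤f) f≤n) disagree
    where
    a≤f = ≤-trans a≤c (<⇒≤ c<f)
    disagree : agree (inInterval a c f) (inInterval a f f) ≡ false
    disagree rewrite dec-true (a ≤? f) a≤f | dec-false (f ≤? c) (<⇒≱ c<f) | dec-true (f ≤? f) ≤-refl = refl
  differAt (tri≈ _ c≡f _) = ⊥-elim (c≢f c≡f)
  differAt (tri> _ _ f<c) = foldr-∧-false _ (∈-run↑ 0 n (≤-trans 1≤a a≤c) c≤n) disagree
    where
    disagree : agree (inInterval a c c) (inInterval a f c) ≡ false
    disagree rewrite dec-true (a ≤? c) a≤c | dec-true (c ≤? c) ≤-refl | dec-false (c ≤? f) (<⇒≱ f<c) = refl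
... | no a≢d | _ = trans (differAt (<-cmp a d)) (sym (cong (_∧ (c ≡ᵇ f)) (dec-false (a ≟ d) a≢d)))
  where
  differAt : Tri (a < d) (a ≡ d) (d < a) → sameOn n (inInterval a c) (inInterval d f) ≡ false
  differAt (tri< a<d _ _) = foldr-∧-false _ (∈-run↑ 0 n 1≤a (≤-trans a≤c c≤n)) disagree
    where
    disagree : agree (inInterval a c a) (inInterval d f a) ≡ false
    disagree rewrite dec-true (a ≤? a) ≤-refl | dec-true (a ≤? c) a≤c | dec-false (d ≤? a) (<⇒≱ a<d) = refl
  differAt (tri≈ _ a≡d _) = ⊥-elim (a≢d a≡d)
  differAt (tri> _ _ d<a) = foldr-∧-false _ (∈-run↑ 0 n 1≤d (≤-trans d≤f f≤n)) disagree
    where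
    disagree : agree (inInterval a c d) (inInterval d f d) ≡ false
    disagree rewrite dec-false (a ≤? d) (<⇒≱ d<a) | dec-true (d ≤? d) ≤-refl | dec-true (d ≤? f) d≤f = refl

module RotatedPositions (p q r : ℕ) where

  n c : ℕ
  n = suc (p + q + r)
  c = suc (p + q)

  y Above Block Below : List ℕ
  y = rotated (p , q , r)
  Above = run↓ (suc c) r
  Block = run↓ (suc p) q
  Below = run↓ 1 p

  y≡ : y ≡ (Above ++ Block) ++ c ∷ Below
  y≡ = sym (++-assoc Above Block (c ∷ Below))

  length-Above++Block : length (Above ++ Block) ≡ r + q
  length-Above++Block = trans (length-++ Above) (cong₂ _+_ (length-run↓ (suc c) r) (length-run↓ (suc p) q))

  Above∌ : ∀ {t} → t ≤ c → All (_≢ t) Above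
  Above∌ t≤c = run↓-∌-below (suc c) r (s≤s t≤c)

  pos-above : ∀ {t} → suc c ≤ t → t < suc c + r → pos y t + t ≡ suc n
  pos-above c<t t<n = pos-run↓ (suc c) r (Block ++ c ∷ Below) c<t t<n

  pos-block : ∀ {t} → suc p ≤ t → t < c → pos y t + t ≡ n
  pos-block {t} p<t t<c = begin
    pos (Above ++ Block ++ c ∷ Below) t + t
      ≡⟨ cong (_+ t) (pos-++ Above (Above∌ (<⇒≤ t<c)) (summand≢0 inBlock t<c)) ⟩
    length Above + pos (Block ++ c ∷ Below) t + t
      ≡⟨ +-assoc (length Above) _ t ⟩
    length Above + (pos (Block ++ c ∷ Below) t + t)
      ≡⟨ cong₂ _+_ (length-run↓ (suc c) r) inBlock ⟩
    r + (suc p + q)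
      ≡⟨ reorder r p q ⟩
    n ∎
    where
    open ≡-Reasoning
    inBlock = pos-run↓ (suc p) q (c ∷ Below) p<t t<c
    reorder : ∀ r p q → r + (suc p + q) ≡ suc (p + q + r)
    reorder = solve-∀

  pos-moved : pos y c ≡ r + q + 1
  pos-moved = begin
    pos y c
      ≡⟨ cong (λ x → pos x c) y≡ ⟩
    pos ((Above ++ Block) ++ c ∷ Below) c
      ≡⟨ pos-++ (Above ++ Block) (All.++⁺ (Above∌ ≤-refl) (run↓-∌-above (suc p) q ≤-refl))
                (pos-head≢0 c Below) ⟩
    length (Above ++ Block) + pos (c ∷ Below) c
      ≡⟨ cong₂ _+_ length-Above++Block (pos-head c Below) ⟩
    r + q + 1 ∎
    where open ≡-Reasoning

  pos-below : ∀ {t} → 1 ≤ t → t < suc p → pos y t + t ≡ suc n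
  pos-below {t} 1≤t t<1+p = begin
    pos y t + t
      ≡⟨ cong (λ x → pos x t + t) y≡ ⟩
    pos ((Above ++ Block) ++ c ∷ Below) t + t
      ≡⟨ cong (_+ t) (pos-++ (Above ++ Block) Above++Block∌ inC∷Below≢0) ⟩
    length (Above ++ Block) + pos (c ∷ Below) t + t
      ≡⟨ cong₂ (λ a b → a + b + t) length-Above++Block (pos-∷ Below c≢t inBelow≢0) ⟩
    r + q + suc (pos Below t) + t
      ≡⟨ reorder r q (pos Below t) t ⟩
    r + q + suc (pos Below t + t)
      ≡⟨ cong (λ x → r + q + suc x) inBelow ⟩
    r + q + suc (suc p)
      ≡⟨ reorder′ r q p ⟩
    suc n ∎
    where
    open ≡-Reasoning
    c≢t : c ≢ t
    c≢t refl = <⇒≱ t<1+p (s≤s (m≤m+n p q))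
    Above++Block∌ : All (_≢ t) (Above ++ Block)
    Above++Block∌ =
      All.++⁺ (Above∌ (≤-trans (≤-pred t<1+p) (m≤n⇒m≤1+n (m≤m+n p q)))) (run↓-∌-below (suc p) q t<1+p)
    inBelow : pos Below t + t ≡ suc p
    inBelow = trans (cong (λ l → pos l t + t) (sym (++-identityʳ Below))) (pos-run↓ 1 p [] 1≤t t<1+p)
    inBelow≢0 = summand≢0 inBelow t<1+p
    inC∷Below≢0 : pos (c ∷ Below) t ≢ 0
    inC∷Below≢0 e = 1+n≢0 (trans (sym (pos-∷ Below c≢t inBelow≢0)) e)
    reorder : ∀ r q x t → r + q + suc x + t ≡ r + q + suc (x + t)
    reorder = solve-∀
    reorder′ : ∀ r q p → r + q + suc (suc p) ≡ suc (suc (p + q + r))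
    reorder′ = solve-∀

  moved≢ : 1 ≤ q → r + q + 1 + c ≢ suc n
  moved≢ 1≤q e =
    <⇒≢ 1≤q (sym (+-cancelˡ-≡ (suc n) q 0 (trans (sym (reorder r q p)) (trans e (sym (+-identityʳ (suc n)))))))
    where
    reorder : ∀ r q p → r + q + 1 + suc (p + q) ≡ suc (suc (p + q + r)) + q
    reorder = solve-∀

  fixed⇔outside : ∀ {t} → 1 ≤ q → 1 ≤ t → t ≤ n →
    (pos y t ≡ᵇ posW0 n t) ≡ not (inInterval (suc p) c t)
  fixed⇔outside {t} 1≤q 1≤t t≤n rewrite ≡ᵇ-∸ (pos y t) t (suc n) (m≤n⇒m≤1+n t≤n) with t ≤? p
  ... | yes t≤p
    rewrite pos-below 1≤t (s≤s t≤p) | dec-true (suc n ≟ suc n) refl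
          | dec-false (suc p ≤? t) (<⇒≱ (s≤s t≤p)) = refl
  ... | no t≰p with t ≤? p + q
  ...   | yes t≤p+q
    rewrite pos-block (≰⇒> t≰p) (s≤s t≤p+q) | dec-false (n ≟ suc n) (<⇒≢ (n<1+n n))
          | dec-true (suc p ≤? t) (≰⇒> t≰p) | dec-true (t ≤? c) (m≤n⇒m≤1+n t≤p+q) = refl
  ...   | no t≰p+q with t ≟ c
  ...     | yes refl
    rewrite pos-moved | dec-false (r + q + 1 + c ≟ suc n) (moved≢ 1≤q)
          | dec-true (suc p ≤? c) (s≤s (m≤m+n p q)) | dec-true (c ≤? c) ≤-refl = refl
  ...     | no t≢c
    rewrite pos-above (≤∧≢⇒< (≰⇒> t≰p+q) (t≢c ∘ sym)) (s≤s t≤n) | dec-true (suc n ≟ suc n) refl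
          | dec-false (t ≤? c) (<⇒≱ (≤∧≢⇒< (≰⇒> t≰p+q) (t≢c ∘ sym))) = cong not (sym (∧-zeroʳ _))

  σ-inside : ∀ {e} → suc p < e → e < c → σ n y e ≡ -[1+ 0 ]
  σ-inside {e} p<e e<c =
    cong (λ b → if b then -[1+ 0 ] else (if posW0 n e <ᵇ pos y e then + 1 else + 0)) (dec-true (_ <? _) left)
    where
    left : pos y e < suc n ∸ e
    left = subst (pos y e <_)
      (trans (sym (m+n∸n≡m (suc (pos y e)) e)) (cong (λ x → suc x ∸ e) (pos-block (<⇒≤ p<e) e<c)))
      (n<1+n _)

  supp-rotated : ∀ {d f} → 1 ≤ q → 1 ≤ d → d ≤ f → f ≤ n →
    suppIs n y d f ≡ (suc p ≡ᵇ d) ∧ (c ≡ᵇ f)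
  supp-rotated {d} {f} 1≤q 1≤d d≤f f≤n =
    trans (cong (λ L → foldr _∧_ true (map moved L)) (idPerm≡run↑ n))
      (trans (cong (foldr _∧_ true) (map-cong-local (All.map pointwise (run↑-bounds 0 n))))
        (sameInterval n (s≤s z≤n) (s≤s (m≤m+n p q)) (s≤s (m≤m+n (p + q) r)) 1≤d d≤f f≤n))
    where
    moved : ℕ → Bool
    moved t = agree (not (pos y t ≡ᵇ posW0 n t)) (inInterval d f t)
    pointwise : ∀ {t} → 0 < t × t ≤ n → moved t ≡ agree (inInterval (suc p) c t) (inInterval d f t)
    pointwise (0<t , t≤n) =
      cong (λ b → agree b (inInterval d f _)) (trans (cong not (fixed⇔outside 1≤q 0<t t≤n)) (not-involutive _))

-- Θ for R₀

matches : ℕ → ℕ → ℕ × ℕ × ℕ → Bool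
matches d f (p , q , r) = (suc p ≡ᵇ d) ∧ (suc (p + q) ≡ᵇ f)

count-first-splits : ∀ {d} → 1 ≤ d → ∀ m →
  countᵇ (λ sj → suc (proj₁ sj) ≡ᵇ d) (splits m) ≡ ind (d ≤ᵇ m)
count-first-splits {d} 1≤d zero rewrite dec-false (d ≤? 0) (<⇒≱ 1≤d) = refl
count-first-splits {d} 1≤d (suc m) = begin
  countᵇ first (map (map₂ suc) (splits m) ++ (m , 1) ∷ [])
    ≡⟨ countᵇ-++ first (map (map₂ suc) (splits m)) _ ⟩
  countᵇ first (map (map₂ suc) (splits m)) + (ind (suc m ≡ᵇ d) + 0)
    ≡⟨ cong₂ _+_ (trans (countᵇ-map first (map₂ suc) (splits m)) (count-first-splits 1≤d m)) (+-identityʳ _) ⟩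
  ind (d ≤ᵇ m) + ind (suc m ≡ᵇ d)
    ≡⟨ step (<-cmp d (suc m)) ⟩
  ind (d ≤ᵇ suc m) ∎
  where
  open ≡-Reasoning
  first : ℕ × ℕ → Bool
  first sj = suc (proj₁ sj) ≡ᵇ d
  step : Tri (d < suc m) (d ≡ suc m) (suc m < d) → ind (d ≤ᵇ m) + ind (suc m ≡ᵇ d) ≡ ind (d ≤ᵇ suc m)
  step (tri< d<1+m _ _)
    rewrite dec-true (d ≤? m) (≤-pred d<1+m) | dec-false (suc m ≟ d) (<⇒≢ d<1+m ∘ sym)
          | dec-true (d ≤? suc m) (<⇒≤ d<1+m) = refl
  step (tri≈ _ refl _)
    rewrite dec-false (suc m ≤? m) (<⇒≱ (n<1+n m)) | dec-true (suc m ≟ suc m) refl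
          | dec-true (suc m ≤? suc m) ≤-refl = refl
  step (tri> _ _ 1+m<d)
    rewrite dec-false (d ≤? m) (<⇒≱ (<-trans (n<1+n m) 1+m<d)) | dec-false (suc m ≟ d) (<⇒≢ 1+m<d)
          | dec-false (d ≤? suc m) (<⇒≱ 1+m<d) = refl

count-matches : ∀ {d f} → 1 ≤ d → d < f → ∀ m → countᵇ (matches d f) (triples m) ≡ ind (f ≤ᵇ m)
count-matches {d} {f} 1≤d d<f zero rewrite dec-false (f ≤? 0) (<⇒≱ (≤-trans (s≤s z≤n) d<f)) = refl
count-matches {d} {f} 1≤d d<f (suc m) = begin
  countᵇ (matches d f) (map (map₂ (map₂ suc)) (triples m) ++ map (λ (s , j) → s , j , 0) (splits m))
    ≡⟨ countᵇ-++ _ (map (map₂ (map₂ suc)) (triples m)) _ ⟩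
  countᵇ (matches d f) (map (map₂ (map₂ suc)) (triples m))
    + countᵇ (matches d f) (map (λ (s , j) → s , j , 0) (splits m))
    ≡⟨ cong₂ _+_ (trans (countᵇ-map _ (map₂ (map₂ suc)) (triples m)) (count-matches 1≤d d<f m))
                 (trans (countᵇ-map _ (λ (s , j) → s , j , 0) (splits m))
                        (countᵇ-congᴬ (splits-valid m) lastBlock)) ⟩
  ind (f ≤ᵇ m) + countᵇ (λ sj → (suc (proj₁ sj) ≡ᵇ d) ∧ (suc m ≡ᵇ f)) (splits m)
    ≡⟨ cong (_+_ (ind (f ≤ᵇ m))) (countᵇ-∧ʳ _ (suc m ≡ᵇ f) (splits m)) ⟩
  ind (f ≤ᵇ m) + (if suc m ≡ᵇ f then countᵇ (λ sj → suc (proj₁ sj) ≡ᵇ d) (splits m) else 0)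
    ≡⟨ cong (λ k → ind (f ≤ᵇ m) + (if suc m ≡ᵇ f then k else 0)) (count-first-splits 1≤d m) ⟩
  ind (f ≤ᵇ m) + (if suc m ≡ᵇ f then ind (d ≤ᵇ m) else 0)
    ≡⟨ step (<-cmp f (suc m)) ⟩
  ind (f ≤ᵇ suc m) ∎
  where
  open ≡-Reasoning
  lastBlock : ∀ {sj} → IsSplit m sj →
    matches d f (proj₁ sj , proj₂ sj , 0) ≡ (suc (proj₁ sj) ≡ᵇ d) ∧ (suc m ≡ᵇ f)
  lastBlock {s , j} (s+j≡m , _) = cong (λ x → (suc s ≡ᵇ d) ∧ (suc x ≡ᵇ f)) s+j≡m
  step : Tri (f < suc m) (f ≡ suc m) (suc m < f) →
    ind (f ≤ᵇ m) + (if suc m ≡ᵇ f then ind (d ≤ᵇ m) else 0) ≡ ind (f ≤ᵇ suc m)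
  step (tri< f<1+m _ _)
    rewrite dec-true (f ≤? m) (≤-pred f<1+m) | dec-false (suc m ≟ f) (<⇒≢ f<1+m ∘ sym)
          | dec-true (f ≤? suc m) (<⇒≤ f<1+m) = refl
  step (tri≈ _ refl _)
    rewrite dec-false (suc m ≤? m) (<⇒≱ (n<1+n m)) | dec-true (suc m ≟ suc m) refl
          | dec-true (d ≤? m) (≤-pred d<f) | dec-true (suc m ≤? suc m) ≤-refl = refl
  step (tri> _ _ 1+m<f)
    rewrite dec-false (f ≤? m) (<⇒≱ (<-trans (n<1+n m) 1+m<f)) | dec-false (suc m ≟ f) (<⇒≢ 1+m<f)
          | dec-false (f ≤? suc m) (<⇒≱ 1+m<f) = refl

≡ᵇ-true⇒≡ : ∀ {m n} → (m ≡ᵇ n) ≡ true → m ≡ n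
≡ᵇ-true⇒≡ {m} {n} e = ≡ᵇ⇒≡ m n (Equivalence.from T-≡ e)

rotated-contribution : ∀ {n d e f} t → IsTriple n t → 1 ≤ d → d < e → e < f → f ≤ n →
  + countᵇ (eqList (rotated t ++ [])) (filterᵇ (λ x → suppIs n x d f) (perms n)) ℤ.* σ n (rotated t ++ []) e
    ≡ ℤ.- (+ ind (matches d f t))
rotated-contribution {n} {d} {e} {f} (p , q , r) (refl , 1≤q) 1≤d d<e e<f f≤n
  rewrite ++-identityʳ (rotated (p , q , r)) = begin
  + countᵇ (eqList y) (filterᵇ (λ x → suppIs n x d f) (perms n)) ℤ.* σ n y e
    ≡⟨ cong (λ k → + k ℤ.* σ n y e) (countᵇ-eqList-filterᵇ y _ (perms n)) ⟩
  + (ind (suppIs n y d f) * countᵇ (eqList y) (perms n)) ℤ.* σ n y e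
    ≡⟨ cong (λ k → + (ind (suppIs n y d f) * k) ℤ.* σ n y e) (count-perms (Perm-rotated p q r)) ⟩
  + (ind (suppIs n y d f) * 1) ℤ.* σ n y e
    ≡⟨ cong (λ b → + (ind b * 1) ℤ.* σ n y e) (supp-rotated 1≤q 1≤d (<⇒≤ (<-trans d<e e<f)) f≤n) ⟩
  + (ind (matches d f (p , q , r)) * 1) ℤ.* σ n y e
    ≡⟨ sign (matches d f (p , q , r)) refl ⟩
  ℤ.- (+ ind (matches d f (p , q , r))) ∎
  where
  open ≡-Reasoning
  open RotatedPositions p q r using (y; σ-inside; supp-rotated)
  sign : ∀ b → matches d f (p , q , r) ≡ b → + (ind b * 1) ℤ.* σ n y e ≡ ℤ.- (+ ind b)
  sign false _ = refl
  sign true match =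
    trans (ℤₚ.*-identityˡ (σ n y e)) (σ-inside (subst (_< e) (sym p+1≡d) d<e) (subst (e <_) (sym c≡f) e<f))
    where
    p+1≡d = ≡ᵇ-true⇒≡ (∧-conicalˡ _ _ match)
    c≡f = ≡ᵇ-true⇒≡ (∧-conicalʳ _ _ match)

three≤ : ∀ {n d e f} → 1 ≤ d → d < e → e < f → f ≤ n → 3 ≤ n
three≤ 1≤d d<e e<f f≤n = ≤-trans (s≤s (≤-trans (s≤s 1≤d) d<e)) (≤-trans e<f f≤n)

Θ-R0 : ∀ n d e f → 1 ≤ d → d < e → e < f → f ≤ n → Θ n (R0 n) d e f ≡ -[1+ 0 ]
Θ-R0 zero d e f 1≤d d<e e<f f≤n with () ← three≤ 1≤d d<e e<f f≤n
Θ-R0 (suc zero) d e f 1≤d d<e e<f f≤n with s≤s () ← three≤ 1≤d d<e e<f f≤n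
Θ-R0 n@(suc (suc m)) d e f 1≤d d<e e<f f≤n = begin
  ∑ (λ x → + D n (R0 n) x ℤ.* σ n x e) P
    ≡⟨ ∑-cong P (λ x → cong (λ k → + k ℤ.* σ n x e) (D≡count x)) ⟩
  ∑ (λ x → + count x E ℤ.* σ n x e) P
    ≡⟨ ∑-count-swap P E (λ x → σ n x e) ⟩
  ∑ contribution E
    ≡⟨ cong (∑ contribution) ends ⟩
  ∑ contribution (map (λ t → rotated t ++ []) (triples n))
    ≡⟨ ∑-map contribution (λ t → rotated t ++ []) (triples n) ⟩
  ∑ (λ t → contribution (rotated t ++ [])) (triples n)
    ≡⟨ ∑-congᴬ (triples-valid n) (λ {t} valid → rotated-contribution t valid 1≤d d<e e<f f≤n) ⟩
  ∑ (λ t → ℤ.- (+ ind (matches d f t))) (triples n)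
    ≡⟨ ∑-negate-ind (matches d f) (triples n) ⟩
  ℤ.- (+ countᵇ (matches d f) (triples n))
    ≡⟨ cong (λ k → ℤ.- (+ k))
            (trans (count-matches 1≤d (<-trans d<e e<f) n) (cong ind (dec-true (f ≤? n) f≤n))) ⟩
  -[1+ 0 ] ∎
  where
  open ≡-Reasoning
  P = filterᵇ (λ x → suppIs n x d f) (perms n)
  E = oneFlipEnds (R0 n) (idPerm n)
  contribution : List ℕ → ℤ
  contribution y = + countᵇ (eqList y) P ℤ.* σ n y e
  D≡count : ∀ x → D n (R0 n) x ≡ count x E
  D≡count x with R0-∷ m | length-R0 n
  ... | R , R0≡ | len≡ rewrite R0≡ = D≡count-oneFlipEnds n 1 R x len≡
  ends : E ≡ map (λ t → rotated t ++ []) (triples n)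
  ends = trans (cong (oneFlipEnds (R0 n)) (trans (idPerm≡run↑ n) (cong (run↑ 0) (sym (+-identityʳ n)))))
               (oneFlipEnds-R0 n 0)

-- First inversion times along R₀

firstInv-here : ∀ {a b k} x i R → pos (swapAt i x) b < pos (swapAt i x) a → firstInv a b k x (i ∷ R) ≡ k
firstInv-here x i R inverted rewrite dec-true (_ <? _) inverted = refl

firstInv-later : ∀ {a b k} x i R → pos (swapAt i x) a < pos (swapAt i x) b →
  firstInv a b k x (i ∷ R) ≡ firstInv a b (suc k) (swapAt i x) R
firstInv-later x i R ordered rewrite dec-false (_ <? _) (<-asym ordered) = refl

swapAt-middle : ∀ X a b Z → swapAt (suc (length X)) (X ++ a ∷ b ∷ Z) ≡ X ++ b ∷ a ∷ Z
swapAt-middle [] a b Z = refl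
swapAt-middle (x ∷ X) a b Z = cong (x ∷_) (swapAt-middle X a b Z)

swapAt-bubbled : ∀ v M i j → swapAt (suc i) (bubbled 1 v M (j , suc i)) ≡ bubbled 1 v M (suc j , i)
swapAt-bubbled v M i j = begin
  swapAt (suc i) (run↓ (suc j) (suc i) ++ v ∷ Rest)
    ≡⟨ cong (λ l → swapAt (suc i) (l ++ v ∷ Rest)) (run↓-∷ʳ (suc j) i) ⟩
  swapAt (suc i) ((Ahead ++ suc j ∷ []) ++ v ∷ Rest)
    ≡⟨ cong (swapAt (suc i)) (++-assoc Ahead (suc j ∷ []) _) ⟩
  swapAt (suc i) (Ahead ++ suc j ∷ v ∷ Rest)
    ≡⟨ cong (λ l → swapAt (suc l) (Ahead ++ suc j ∷ v ∷ Rest)) (sym (length-run↓ (suc (suc j)) i)) ⟩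
  swapAt (suc (length Ahead)) (Ahead ++ suc j ∷ v ∷ Rest)
    ≡⟨ swapAt-middle Ahead (suc j) v Rest ⟩
  bubbled 1 v M (suc j , i) ∎
  where
  open ≡-Reasoning
  Ahead = run↓ (suc (suc j)) i
  Rest = run↓ 1 j ++ M

firstInv-desc-below : ∀ {α β v k} i j K R → suc (i + j) ≡ v → v < β → β ≤ v + k → α < β →
  firstInv α β K (bubbled 1 v (run↑ v k) (j , i)) (desc i ++ R)
    ≡ firstInv α β (K + i) (bubbled 1 v (run↑ v k) (i + j , 0)) R
firstInv-desc-below zero j K R _ _ _ _ = cong (λ K′ → firstInv _ _ K′ _ R) (sym (+-identityʳ K))
firstInv-desc-below {α} {β} {v} {k} (suc i) j K R i+j+1≡v v<β β≤v+k α<β = begin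
  firstInv α β K (bubbled 1 v M (j , suc i)) (suc i ∷ desc i ++ R)
    ≡⟨ firstInv-later (bubbled 1 v M (j , suc i)) (suc i) (desc i ++ R)
                      (subst (λ y → pos y α < pos y β) (sym next) (increasing-tail X X≤v v<β β≤v+k α<β)) ⟩
  firstInv α β (suc K) (swapAt (suc i) (bubbled 1 v M (j , suc i))) (desc i ++ R)
    ≡⟨ cong (λ y → firstInv α β (suc K) y (desc i ++ R)) (swapAt-bubbled v M i j) ⟩
  firstInv α β (suc K) (bubbled 1 v M (suc j , i)) (desc i ++ R)
    ≡⟨ firstInv-desc-below i (suc j) (suc K) R (trans (cong suc (+-suc i j)) i+j+1≡v) v<β β≤v+k α<β ⟩
  firstInv α β (suc K + i) (bubbled 1 v M (i + suc j , 0)) R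
    ≡⟨ cong₂ (λ K′ w → firstInv α β K′ (bubbled 1 v M (w , 0)) R) (sym (+-suc K i)) (+-suc i j) ⟩
  firstInv α β (K + suc i) (bubbled 1 v M (suc i + j , 0)) R ∎
  where
  open ≡-Reasoning
  M = run↑ v k
  X = run↓ (suc (suc j)) i ++ v ∷ run↓ 1 (suc j)
  next : swapAt (suc i) (bubbled 1 v M (j , suc i)) ≡ X ++ M
  next = trans (swapAt-bubbled v M i j) (sym (++-assoc (run↓ (suc (suc j)) i) _ M))
  2+j+i≡v : suc (suc j) + i ≡ v
  2+j+i≡v = trans (cong (suc ∘ suc) (+-comm j i)) i+j+1≡v
  X≤v : All (_≤ v) X
  X≤v = All.++⁺ (All.map (λ (_ , x<) → <⇒≤ (≤-trans x< 2+j+i≤v)) (run↓-bounds (suc (suc j)) i))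
                (≤-refl ∷ All.map (λ (_ , x<) → <⇒≤ (≤-trans x< (≤-trans (m≤m+n (suc (suc j)) i) 2+j+i≤v)))
                                  (run↓-bounds 1 (suc j)))
    where 2+j+i≤v = ≤-reflexive 2+j+i≡v

firstInv-desc-at : ∀ {β k} i j u K R → suc (i + j) ≡ β → u < i →
  firstInv (suc j + u) β K (bubbled 1 β (run↑ β k) (j , i)) (desc i ++ R) ≡ K + u
firstInv-desc-at {β} {k} (suc i) j u K R i+j+1≡β u<i+1 = catch u u<i+1
  where
  M = run↑ β k
  Ahead = run↓ (suc (suc j)) i
  S = bubbled 1 β M (j , suc i)
  S′ = Ahead ++ β ∷ run↓ 1 (suc j) ++ M
  next : swapAt (suc i) S ≡ S′
  next = swapAt-bubbled β M i j
  2+j+i≡β : suc (suc j) + i ≡ β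
  2+j+i≡β = trans (cong (suc ∘ suc) (+-comm j i)) i+j+1≡β
  posβ : pos S′ β ≡ length Ahead + 1
  posβ = trans (pos-++ Ahead (run↓-∌-above (suc (suc j)) i (≤-reflexive 2+j+i≡β))
                            (pos-head≢0 β (run↓ 1 (suc j) ++ M)))
               (cong (_+_ (length Ahead)) (pos-head β (run↓ 1 (suc j) ++ M)))
  catch : ∀ u → u < suc i → firstInv (suc j + u) β K S (suc i ∷ desc i ++ R) ≡ K + u
  catch zero _ =
    trans (firstInv-here S (suc i) (desc i ++ R) (subst (λ y → pos y β < pos y (suc j + 0)) (sym next) inverted))
          (sym (+-identityʳ K))
    where
    β≢1+j : β ≢ suc j
    β≢1+j β≡1+j = <-irrefl (sym β≡1+j) (subst (suc j <_) 2+j+i≡β (s≤s (m≤m+n (suc j) i)))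
    second : pos (β ∷ suc j ∷ run↓ 1 j ++ M) (suc j) ≡ 2
    second = trans (pos-∷ (suc j ∷ run↓ 1 j ++ M) β≢1+j (pos-head≢0 (suc j) (run↓ 1 j ++ M)))
                   (cong suc (pos-head (suc j) (run↓ 1 j ++ M)))
    posα : pos S′ (suc j + 0) ≡ length Ahead + 2
    posα rewrite +-identityʳ j =
      trans (pos-++ Ahead (run↓-∌-below (suc (suc j)) i ≤-refl) (λ e → 1+n≢0 (trans (sym second) e)))
            (cong (_+_ (length Ahead)) second)
    inverted : pos S′ β < pos S′ (suc j + 0)
    inverted = subst₂ _<_ (sym posβ) (sym posα) (+-monoʳ-< (length Ahead) ≤-refl)
  catch (suc u) u+1<i+1 = begin
    firstInv α β K S (suc i ∷ desc i ++ R)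
      ≡⟨ firstInv-later S (suc i) (desc i ++ R) (subst (λ y → pos y α < pos y β) (sym next) ordered) ⟩
    firstInv α β (suc K) (swapAt (suc i) S) (desc i ++ R)
      ≡⟨ cong₂ (λ a y → firstInv a β (suc K) y (desc i ++ R)) α≡ (swapAt-bubbled β M i j) ⟩
    firstInv (suc (suc j) + u) β (suc K) (bubbled 1 β M (suc j , i)) (desc i ++ R)
      ≡⟨ firstInv-desc-at i (suc j) u (suc K) R (trans (cong suc (+-suc i j)) i+j+1≡β) (≤-pred u+1<i+1) ⟩
    suc K + u
      ≡⟨ sym (+-suc K u) ⟩
    K + suc u ∎
    where
    open ≡-Reasoning
    α = suc j + suc u
    α≡ : α ≡ suc (suc j) + u
    α≡ = +-suc (suc j) u
    2+j≤α : suc (suc j) ≤ α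
    2+j≤α = subst (suc (suc j) ≤_) (sym α≡) (m≤m+n (suc (suc j)) u)
    α<2+j+i : α < suc (suc j) + i
    α<2+j+i = subst (_< suc (suc j) + i) (sym α≡) (+-monoʳ-< (suc (suc j)) (≤-pred u+1<i+1))
    posα+α : pos S′ α + α ≡ suc (suc j) + i
    posα+α = pos-run↓ (suc (suc j)) i (β ∷ run↓ 1 (suc j) ++ M) 2+j≤α α<2+j+i
    posα≤i : pos S′ α ≤ i
    posα≤i = +-cancelʳ-≤ α _ i (≤-trans (≤-reflexive posα+α)
                                         (≤-trans (+-monoˡ-≤ i 2+j≤α) (≤-reflexive (+-comm α i))))
    ordered : pos S′ α < pos S′ β
    ordered = subst (pos S′ α <_) (sym (trans posβ (trans (cong (_+ 1) (length-run↓ (suc (suc j)) i)) (+-comm i 1))))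
                    (s≤s posα≤i)

firstInv-R0 : ∀ {α β} m k K R → m < β → α < β → β ≤ m + k →
  firstInv α β K (run↑ 0 (m + k)) (R0 m ++ R) ≡ firstInv α β (K + length (R0 m)) (run↓ 1 m ++ run↑ m k) R
firstInv-R0 zero k K R _ _ _ = cong (λ K′ → firstInv _ _ K′ (run↑ 0 k) R) (sym (+-identityʳ K))
firstInv-R0 {α} {β} (suc m) k K R m<β α<β β≤m+k = begin
  firstInv α β K (run↑ 0 (suc m + k)) ((R0 m ++ desc m) ++ R)
    ≡⟨ cong₂ (λ w R′ → firstInv α β K (run↑ 0 w) R′) (sym (+-suc m k)) (++-assoc (R0 m) (desc m) R) ⟩
  firstInv α β K (run↑ 0 (m + suc k)) (R0 m ++ desc m ++ R)
    ≡⟨ firstInv-R0 m (suc k) K (desc m ++ R) (<-trans (n<1+n m) m<β) α<β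
                   (≤-trans β≤m+k (≤-reflexive (sym (+-suc m k)))) ⟩
  firstInv α β (K + length (R0 m)) (bubbled 1 (suc m) (run↑ (suc m) k) (0 , m)) (desc m ++ R)
    ≡⟨ firstInv-desc-below m 0 _ R (cong suc (+-identityʳ m)) m<β β≤m+k α<β ⟩
  firstInv α β (K + length (R0 m) + m) (bubbled 1 (suc m) (run↑ (suc m) k) (m + 0 , 0)) R
    ≡⟨ cong₂ (λ K′ w → firstInv α β K′ (suc m ∷ run↓ 1 w ++ run↑ (suc m) k) R) steps (+-identityʳ m) ⟩
  firstInv α β (K + length (R0 m ++ desc m)) (run↓ 1 (suc m) ++ run↑ (suc m) k) R ∎
  where
  open ≡-Reasoning
  steps : K + length (R0 m) + m ≡ K + length (R0 m ++ desc m)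
  steps = trans (+-assoc K _ m)
                (cong (_+_ K) (sym (trans (length-++ (R0 m)) (cong (_+_ (length (R0 m))) (length-desc m)))))

R0-prefix : ∀ {b n} → b ≤′ n → Σ (List ℕ) λ R → R0 n ≡ R0 b ++ R
R0-prefix ≤′-refl = [] , sym (++-identityʳ _)
R0-prefix {b} (≤′-step {n} b≤′n) with R0-prefix b≤′n
... | R , R0≡ = R ++ desc n , trans (cong (_++ desc n) R0≡) (++-assoc (R0 b) R (desc n))

length-R0-mono : ∀ {b n} → b ≤ n → length (R0 b) ≤ length (R0 n)
length-R0-mono {b} b≤n with R0-prefix (≤⇒≤′ b≤n)
... | R , R0≡ = ≤-trans (m≤m+n _ (length R)) (≤-reflexive (trans (sym (length-++ (R0 b))) (cong length (sym R0≡))))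

τ-R0 : ∀ n α β → α < β → β < n → τ n (R0 n) (suc α) (suc β) ≡ suc (length (R0 β) + α)
τ-R0 n α β α<β β<n with m≤n⇒∃[o]m+o≡n β<n
... | o , refl with R0-prefix (≤⇒≤′ (m≤m+n (suc β) o))
... | R , R0≡ = begin
  firstInv (suc α) (suc β) 1 (idPerm (suc β + o)) (R0 (suc β + o))
    ≡⟨ cong₂ (firstInv (suc α) (suc β) 1) start (trans R0≡ (++-assoc (R0 β) (desc β) R)) ⟩
  firstInv (suc α) (suc β) 1 (run↑ 0 (β + suc o)) (R0 β ++ desc β ++ R)
    ≡⟨ firstInv-R0 β (suc o) 1 (desc β ++ R) (n<1+n β) (s≤s α<β)
                   (≤-trans (s≤s (m≤m+n β o)) (≤-reflexive (sym (+-suc β o)))) ⟩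
  firstInv (suc α) (suc β) (1 + length (R0 β)) (bubbled 1 (suc β) (run↑ (suc β) o) (0 , β)) (desc β ++ R)
    ≡⟨ firstInv-desc-at β 0 α _ R (cong suc (+-identityʳ β)) α<β ⟩
  suc (length (R0 β) + α) ∎
  where
  open ≡-Reasoning
  start : idPerm (suc β + o) ≡ run↑ 0 (β + suc o)
  start = trans (idPerm≡run↑ _) (cong (run↑ 0) (sym (+-suc β o)))

T-R0 : ∀ n d e f → 1 ≤ d → d < e → e < f → f ≤ n → T n (R0 n) d e f ≡ + 1
T-R0 n (suc d) (suc e) (suc f) _ (s≤s d<e) (s≤s e<f) f<n
  rewrite τ-R0 n d e d<e (<-trans e<f f<n) | τ-R0 n e f e<f f<n
        | dec-true (suc (length (R0 e) + d) <? suc (length (R0 f) + e))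
                   (s≤s (+-mono-≤-< (length-R0-mono (<⇒≤ e<f)) d<e)) = refl

proposition3p28 : (n d e f : ℕ) → 1 ≤ d → d < e → e < f → f ≤ n →
    (T n (R0 n) d e f ≡ + 1) × (Θ n (R0 n) d e f ≡ -[1+ 0 ])
proposition3p28 n d e f 1≤d d<e e<f f≤n = T-R0 n d e f 1≤d d<e e<f f≤n , Θ-R0 n d e f 1≤d d<e e<f f≤n
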